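{- Let $Q_n(x,y,z,t)$ be the polynomials defined by $Q_1=1$ and $Q_{n+1}=\bigl[x+nz+(y+t)(n+y\,\partial_y)\bigr]Q_n$ for $n\ge1$, and set $R_n(x,y,z,t)=Q_n(x,y+1,z,t-1)$. Then for every $n\ge1$, \[ R_n(x,y,z,t)=\sum_{T\in\mathcal{G}_{n+1}} y^{\operatorname{unl}(T)}\,t^{\operatorname{impp}(T)}\,x^{\deg_T(1)-1}\,z^{\operatorname{lead}(T)-\deg_T(1)-1}. \]
   Context: A Greg tree of size $m$ is a (finite) tree in which exactly $m$ vertices are labelled, bijectively by $[m]=\{1,\dots,m\}$, and every unlabelled vertex has degree at least $3$. $\mathcal{G}_m$ is the set of Greg trees of size $m$, rooted at the vertex labelled $1$. $\lambda_T$ denotes the labelling function (defined only on labelled vertices). Edges are oriented from parent to child: $(i,j)$ means $i$ is the parent of $j$. $\deg_T(1)$ is the degree of the root (its number of children). $\operatorname{unl}(T)$ is the number of unlabelled vertices. For any vertex $v$, $\beta_T(v)$ is the smallest label among the labelled descendants of $v$ ($v$ counts as its own descendant). An edge $(i,j)$ is improper if $i$ is labelled and $\lambda_T(i)>\beta_T(j)$; then $j$ is an improper child of $i$. A vertex is an improper parent if it has at least one improper child (equivalently, it is labelled and $\beta_T(i)\ne\lambda_T(i)$); $\operatorname{impp}(T)$ is the number of improper parents. For a labelled vertex $i$ with root-to-$i$ path $L(i)=(1=a_0,\dots,a_k=i)$, its greater ancestors path is the longest terminal segment $(a_p,\dots,a_k)$ of $L(i)$ such that every labelled vertex $j$ in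 it satisfies $\lambda_T(j)\ge\lambda_T(i)$ (unlabelled vertices impose no condition); $i$ is leading if $\beta_T(a_p)=\lambda_T(i)$. $\operatorname{lead}(T)$ is the number of leading vertices. -}

module Defs where

open import Data.Nat as ℕ using (ℕ; zero; suc; _≤_; _<_; _∸_; _⊓_; _≡ᵇ_; _≤ᵇ_; _<ᵇ_)
open import Data.Integer as ℤ using (ℤ; +_)
open import Data.Bool using (Bool; true; false; if_then_else_)
open import Data.Maybe using (Maybe; just; nothing)
open import Data.List using (List; []; _∷_; _++_; map; length; foldr; upTo)
open import Data.Bool.ListAction using (any)
open import Data.Product using (_×_; _,_)
open import Data.Unit using (⊤)
open import Relation.Binary.PropositionalEquality using (_≡_)
open import Data.List.Relation.Binary.Permutation.Propositional using (_↭_)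
open import Data.List.Relation.Unary.Unique.Propositional using (Unique)
open import Data.List.Membership.Propositional using (_∈_)
open import Function.Bundles using (_⇔_)

-- Polynomials in ℤ[x,y,z,t] as (unnormalised) lists of terms
-- c * x^a * y^b * z^c * t^d

record Term : Set where
  constructor term
  field
    coef : ℤ
    ex ey ez et : ℕ
open Term public

Poly : Set
Poly = List Term

one : Poly
one = term (+ 1) 0 0 0 0 ∷ []

mulX mulY mulZ mulT : Poly → Poly
mulX = map λ { (term c a b e d) → term c (suc a) b e d }
mulY = map λ { (term c a b e d) → term c a (suc b) e d }
mulZ = map λ { (term c a b e d) → term c a b (suc e) d }
mulT = map λ { (term c a b e d) → term c a b e (suc d) }

scale : ℕ → Poly → Poly
scale k = map λ { (term c a b e d) → term (+ k ℤ.* c) a b e d }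

yDy : Poly → Poly
yDy = map λ { (term c a b e d) → term (+ b ℤ.* c) a b e d }

step : ℕ → Poly → Poly
step n p = mulX p ++ scale n (mulZ p) ++ mulY w ++ mulT w
  where w = scale n p ++ yDy p

-- Q 1 = 1, Q (n+1) = step n (Q n) for n ≥ 1   (Q 0 is unused)
Q : ℕ → Poly
Q zero = []
Q (suc zero) = one
Q (suc (suc k)) = step (suc k) (Q (suc k))

evalTerm : ℤ → ℤ → ℤ → ℤ → Term → ℤ
evalTerm x y z t (term c a b e d) = c ℤ.* (x ℤ.^ a) ℤ.* (y ℤ.^ b) ℤ.* (z ℤ.^ e) ℤ.* (t ℤ.^ d)

eval : Poly → ℤ → ℤ → ℤ → ℤ → ℤ
eval p x y z t = foldr ℤ._+_ (+ 0) (map (evalTerm x y z t) p)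

R : ℕ → ℤ → ℤ → ℤ → ℤ → ℤ
R n x y z t = eval (Q n) x (y ℤ.+ + 1) z (t ℤ.- + 1)

data Tree : Set where
  node : Maybe ℕ → List Tree → Tree

label : Tree → Maybe ℕ
label (node l _) = l

children : Tree → List Tree
children (node _ cs) = cs

mutual
  labels : Tree → List ℕ
  labels (node nothing cs) = labelsL cs
  labels (node (just l) cs) = l ∷ labelsL cs

  labelsL : List Tree → List ℕ
  labelsL [] = []
  labelsL (c ∷ cs) = labels c ++ labelsL cs

minL : List ℕ → ℕ
minL [] = 0
minL (x ∷ xs) = foldr _⊓_ x xs

β : Tree → ℕ
β v = minL (labels v)

mutual
  AllNodes : (Maybe ℕ → List Tree → Set) → Tree → Set
  AllNodes P (node l cs) = P l cs × AllNodesL P cs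

  AllNodesL : (Maybe ℕ → List Tree → Set) → List Tree → Set
  AllNodesL P [] = ⊤
  AllNodesL P (c ∷ cs) = AllNodes P c × AllNodesL P cs

Increasing : List ℕ → Set
Increasing [] = ⊤
Increasing (x ∷ []) = ⊤
Increasing (x ∷ y ∷ r) = x < y × Increasing (y ∷ r)

-- Unlabelled vertices have degree ≥ 3 (they are never the root, so
-- this means ≥ 2 children).
DegreeCond : Maybe ℕ → List Tree → Set
DegreeCond nothing cs = 2 ≤ length cs
DegreeCond (just _) cs = ⊤

-- Canonical form: children listed in increasing order of β.
-- (Isomorphism classes of Greg trees correspond bijectively to such trees.)
Canonical : Maybe ℕ → List Tree → Set
Canonical _ cs = Increasing (map β cs)

record GregTree (m : ℕ) (T : Tree) : Set where
  field
    rootIs1   : label T ≡ just 1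
    labelling : labels T ↭ map suc (upTo m)
    degree    : AllNodes DegreeCond T
    canonical : AllNodes Canonical T

Enumerates : ℕ → List Tree → Set
Enumerates m L = Unique L × (∀ T → (T ∈ L) ⇔ GregTree m T)

mutual
  unl : Tree → ℕ
  unl (node nothing cs) = suc (unlL cs)
  unl (node (just _) cs) = unlL cs

  unlL : List Tree → ℕ
  unlL [] = 0
  unlL (c ∷ cs) = unl c ℕ.+ unlL cs

degRoot : Tree → ℕ
degRoot T = length (children T)

mutual
  impp : Tree → ℕ
  impp (node nothing cs) = imppL cs
  impp (node (just l) cs) =
    (if any (λ c → β c <ᵇ l) cs then 1 else 0) ℕ.+ imppL cs

  imppL : List Tree → ℕ
  imppL [] = 0
  imppL (c ∷ cs) = impp c ℕ.+ imppL cs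

-- top of the greater ancestors path of a vertex with label l:
-- current vertex v, ancestors listed nearest first
gapTop : ℕ → Tree → List Tree → Tree
gapTop l v [] = v
gapTop l v (a ∷ as) with label a
... | nothing = gapTop l a as
... | just k = if l ≤ᵇ k then gapTop l a as else v

mutual
  leadT : List Tree → Tree → ℕ
  leadT anc (node nothing cs) = leadL (node nothing cs ∷ anc) cs
  leadT anc (node (just l) cs) =
    (if β (gapTop l (node (just l) cs) anc) ≡ᵇ l then 1 else 0)
      ℕ.+ leadL (node (just l) cs ∷ anc) cs

  leadL : List Tree → List Tree → ℕ
  leadL anc [] = 0
  leadL anc (c ∷ cs) = leadT anc c ℕ.+ leadL anc cs

lead : Tree → ℕ
lead T = leadT [] T

weight : ℤ → ℤ → ℤ → ℤ → Tree → ℤ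
weight x y z t T =
  (y ℤ.^ unl T) ℤ.* (t ℤ.^ impp T) ℤ.* (x ℤ.^ (degRoot T ∸ 1))
    ℤ.* (z ℤ.^ (lead T ∸ degRoot T ∸ 1))

sumℤ : List ℤ → ℤ
sumℤ = foldr ℤ._+_ (+ 0)

module Submission where

-- Both sides are compared together with all their y-derivatives.  From
-- Q_{n+1} = [x + nz + (y+t)(n + y∂y)] Q_n, the j-th y-derivative of R_{n+1}
-- is a fixed linear combination (`stepDeriv`) of the derivatives of orders
-- j-1, j, j+1 of R_n (module Derivatives).  On the tree side, 𝒢_{n+2} is
-- obtained from 𝒢_{n+1} by inserting the largest label n+2 in one of six
-- ways (module GregTrees); each way changes the statistics in a fixed
-- manner, and the number of ways of each kind depends only on the numbers
-- of labelled and unlabelled vertices.  A ring identity (`monomial-step`)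
-- shows that the derivatives of the weights of the trees grown from one tree
-- obey the same three-term recurrence (module Recurrence).  Induction on n,
-- for all orders j at once, gives the identity for j = 0; finally any
-- enumeration of 𝒢_{n+1} is a permutation of the one constructed here.

module Derivatives where
  open import Defs
  open import Data.Nat using (ℕ; zero; suc; _∸_)
  open import Data.Integer using (ℤ; +_; _+_; _*_; _-_; _^_; 1ℤ; 0ℤ)
  import Data.Integer.Properties as ℤP
  open import Data.List using ([]; _∷_; _++_; map)
  import Data.List.Properties as LP
  open import Relation.Binary.PropositionalEquality
  open import Data.Integer.Tactic.RingSolver using (solve-∀)
  open ≡-Reasoning

  -- ∂pow u b j is the value at y = u of the j-th derivative of y ↦ yᵇ,
  -- that is b (b-1) ⋯ (b-j+1) u^(b-j); the recursion is the Leibniz rule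
  -- for y^(b+1) = y · yᵇ.
  ∂pow : ℤ → ℕ → ℕ → ℤ
  ∂pow u zero zero = 1ℤ
  ∂pow u zero (suc j) = 0ℤ
  ∂pow u (suc b) zero = u * ∂pow u b zero
  ∂pow u (suc b) (suc j) = u * ∂pow u b (suc j) + + suc j * ∂pow u b j

  ∂pow-zero : ∀ u b → ∂pow u b 0 ≡ u ^ b
  ∂pow-zero u zero = refl
  ∂pow-zero u (suc b) = cong (u *_) (∂pow-zero u b)

  -- A product j * f (j ∸ 1 + 1) does not depend on how the index is
  -- written, since the factor j vanishes in the only case j ∸ 1 + 1 ≢ j.
  weight-pred-suc : ∀ (f : ℕ → ℤ) j → + j * f (suc (j ∸ 1)) ≡ + j * f j
  weight-pred-suc f zero = trans (ℤP.*-zeroˡ (f 1)) (sym (ℤP.*-zeroˡ (f 0)))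
  weight-pred-suc f (suc j) = refl

  ∂pow-suc : ∀ u b j → ∂pow u (suc b) j ≡ u * ∂pow u b j + + j * ∂pow u b (j ∸ 1)
  ∂pow-suc u b zero = sym (trans (cong (λ q → u * ∂pow u b 0 + q) (ℤP.*-zeroˡ (∂pow u b 0)))
                                 (ℤP.+-identityʳ (u * ∂pow u b 0)))
  ∂pow-suc u b (suc j) = refl

  ∂pow-lower : ∀ u b j → + b * ∂pow u (b ∸ 1) j ≡ ∂pow u b (suc j)
  ∂pow-lower u zero j = ℤP.*-zeroˡ (∂pow u 0 j)
  ∂pow-lower u (suc b) j = sym (lower b j)
    where
    lower : ∀ b j → ∂pow u (suc b) (suc j) ≡ + suc b * ∂pow u b j
    base₀ : ∀ u → u * 0ℤ + 1ℤ * 1ℤ ≡ 1ℤ * 1ℤ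
    base₀ = solve-∀
    base₁ : ∀ u J → u * 0ℤ + J * 0ℤ ≡ 1ℤ * 0ℤ
    base₁ = solve-∀
    lower zero zero = base₀ u
    lower zero (suc j) = base₁ u (+ suc (suc j))
    lower (suc b) zero = begin
      u * ∂pow u (suc b) 1 + 1ℤ * (u * ∂pow u b 0) ≡⟨ cong (λ q → u * q + 1ℤ * (u * ∂pow u b 0)) (lower b zero) ⟩
      u * (+ suc b * ∂pow u b 0) + 1ℤ * (u * ∂pow u b 0) ≡⟨ identity u (+ b) (∂pow u b 0) ⟩
      + suc (suc b) * (u * ∂pow u b 0) ∎
      where
      identity : ∀ u B f → u * ((1ℤ + B) * f) + 1ℤ * (u * f) ≡ (1ℤ + (1ℤ + B)) * (u * f)
      identity = solve-∀
    lower (suc b) (suc j) = begin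
      u * ∂pow u (suc b) (suc (suc j)) + + suc (suc j) * X
        ≡⟨ cong (λ q → u * q + + suc (suc j) * X) (lower b (suc j)) ⟩
      u * (+ suc b * ∂pow u b (suc j)) + + suc (suc j) * X
        ≡⟨ split u (+ b) (+ j) (∂pow u b (suc j)) X ⟩
      X + u * (+ suc b * ∂pow u b (suc j)) + + suc j * X
        ≡⟨ cong (λ q → X + u * (+ suc b * ∂pow u b (suc j)) + + suc j * q) (lower b j) ⟩
      X + u * (+ suc b * ∂pow u b (suc j)) + + suc j * (+ suc b * ∂pow u b j)
        ≡⟨ collect u (+ b) (+ j) (∂pow u b (suc j)) (∂pow u b j) ⟩
      + suc (suc b) * X ∎
      where
      X = ∂pow u (suc b) (suc j)
      split : ∀ u B J f X → u * ((1ℤ + B) * f) + (1ℤ + (1ℤ + J)) * X ≡ X + u * ((1ℤ + B) * f) + (1ℤ + J) * X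
      split = solve-∀
      collect : ∀ u B J f₁ f₀ →
        (u * f₁ + (1ℤ + J) * f₀) + u * ((1ℤ + B) * f₁) + (1ℤ + J) * ((1ℤ + B) * f₀)
          ≡ (1ℤ + (1ℤ + B)) * (u * f₁ + (1ℤ + J) * f₀)
      collect = solve-∀

  ∂pow-euler : ∀ u b j → + b * ∂pow u b j ≡ u * ∂pow u b (suc j) + + j * ∂pow u b j
  ∂pow-euler u zero zero = vanish u
    where
    vanish : ∀ u → 0ℤ * 1ℤ ≡ u * 0ℤ + 0ℤ * 1ℤ
    vanish = solve-∀
  ∂pow-euler u zero (suc j) = vanish u (+ suc j)
    where
    vanish : ∀ u J → 0ℤ * 0ℤ ≡ u * 0ℤ + J * 0ℤ
    vanish = solve-∀
  ∂pow-euler u (suc c) j = begin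
    + suc c * ∂pow u (suc c) j
      ≡⟨ cong (+ suc c *_) (∂pow-suc u c j) ⟩
    + suc c * (u * ∂pow u c j + + j * ∂pow u c (j ∸ 1))
      ≡⟨ distribute u (+ suc c) (+ j) (∂pow u c j) (∂pow u c (j ∸ 1)) ⟩
    u * (+ suc c * ∂pow u c j) + + j * (+ suc c * ∂pow u c (j ∸ 1))
      ≡⟨ cong₂ (λ p q → u * p + + j * q) (∂pow-lower u (suc c) j) (∂pow-lower u (suc c) (j ∸ 1)) ⟩
    u * ∂pow u (suc c) (suc j) + + j * ∂pow u (suc c) (suc (j ∸ 1))
      ≡⟨ cong (λ q → u * ∂pow u (suc c) (suc j) + q) (weight-pred-suc (∂pow u (suc c)) j) ⟩
    u * ∂pow u (suc c) (suc j) + + j * ∂pow u (suc c) j ∎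
    where
    distribute : ∀ u B J f g → B * (u * f + J * g) ≡ u * (B * f) + J * (B * g)
    distribute = solve-∀

  -- Euler's identity one order lower, weighted by j so that it also holds for j = 0.
  ∂pow-euler-pred : ∀ u b j →
    + j * (+ b * ∂pow u b (j ∸ 1)) ≡ + j * (u * ∂pow u b j + + (j ∸ 1) * ∂pow u b (j ∸ 1))
  ∂pow-euler-pred u b j = trans (cong (+ j *_) (∂pow-euler u b (j ∸ 1)))
    (weight-pred-suc (λ k → u * ∂pow u b k + + (j ∸ 1) * ∂pow u b (j ∸ 1)) j)

  ∂term : ℤ → ℤ → ℤ → ℤ → ℕ → Term → ℤ
  ∂term x u z w j (term c a b e d) = c * x ^ a * ∂pow u b j * z ^ e * w ^ d

  ∂eval : ℤ → ℤ → ℤ → ℤ → ℕ → Poly → ℤ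
  ∂eval x u z w j p = sumℤ (map (∂term x u z w j) p)

  eval-∂eval : ∀ p x u z w → eval p x u z w ≡ ∂eval x u z w 0 p
  eval-∂eval [] x u z w = refl
  eval-∂eval (term c a b e d ∷ p) x u z w =
    cong₂ _+_ (cong (λ q → c * x ^ a * q * z ^ e * w ^ d) (sym (∂pow-zero u b))) (eval-∂eval p x u z w)

  sum-++ : ∀ xs ys → sumℤ (xs ++ ys) ≡ sumℤ xs + sumℤ ys
  sum-++ [] ys = sym (ℤP.+-identityˡ _)
  sum-++ (a ∷ xs) ys = trans (cong (λ q → a + q) (sum-++ xs ys)) (sym (ℤP.+-assoc a _ _))

  sum-scale : ∀ {A : Set} (f g : A → ℤ) α → (∀ a → f a ≡ α * g a) → ∀ xs →
    sumℤ (map f xs) ≡ α * sumℤ (map g xs)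
  sum-scale f g α e [] = sym (ℤP.*-zeroʳ α)
  sum-scale f g α e (a ∷ xs) =
    trans (cong₂ _+_ (e a) (sum-scale f g α e xs)) (sym (ℤP.*-distribˡ-+ α (g a) _))

  sum-linear : ∀ {A : Set} (f g h : A → ℤ) α β → (∀ a → f a ≡ α * g a + β * h a) → ∀ xs →
    sumℤ (map f xs) ≡ α * sumℤ (map g xs) + β * sumℤ (map h xs)
  sum-linear f g h α β e [] = vanish α β
    where
    vanish : ∀ α β → 0ℤ ≡ α * 0ℤ + β * 0ℤ
    vanish = solve-∀
  sum-linear f g h α β e (a ∷ xs) =
    trans (cong₂ _+_ (e a) (sum-linear f g h α β e xs)) (regroup α β (g a) (h a) _ _)
    where
    regroup : ∀ α β g h G H → α * g + β * h + (α * G + β * H) ≡ α * (g + G) + β * (h + H)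
    regroup = solve-∀

  module ∂Calculus (x u z w : ℤ) where
    D : ℕ → Poly → ℤ
    D = ∂eval x u z w

    ∂t : ℕ → Term → ℤ
    ∂t = ∂term x u z w

    D-map : ∀ j (f : Term → Term) p → D j (map f p) ≡ sumℤ (map (λ τ → ∂t j (f τ)) p)
    D-map j f p = cong sumℤ (sym (LP.map-∘ p))

    D-++ : ∀ j p q → D j (p ++ q) ≡ D j p + D j q
    D-++ j p q = trans (cong sumℤ (LP.map-++ (∂t j) p q)) (sum-++ (map (∂t j) p) (map (∂t j) q))

    D-mulX : ∀ j p → D j (mulX p) ≡ x * D j p
    D-mulX j p = trans (D-map j _ p) (sum-scale _ (∂t j) x
      (λ { (term c a b e d) → shift x c (x ^ a) (∂pow u b j) (z ^ e) (w ^ d) }) p)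
      where
      shift : ∀ x c X F Z W → c * (x * X) * F * Z * W ≡ x * (c * X * F * Z * W)
      shift = solve-∀

    D-mulZ : ∀ j p → D j (mulZ p) ≡ z * D j p
    D-mulZ j p = trans (D-map j _ p) (sum-scale _ (∂t j) z
      (λ { (term c a b e d) → shift z c (x ^ a) (∂pow u b j) (z ^ e) (w ^ d) }) p)
      where
      shift : ∀ z c X F Z W → c * X * F * (z * Z) * W ≡ z * (c * X * F * Z * W)
      shift = solve-∀

    D-mulT : ∀ j p → D j (mulT p) ≡ w * D j p
    D-mulT j p = trans (D-map j _ p) (sum-scale _ (∂t j) w
      (λ { (term c a b e d) → shift w c (x ^ a) (∂pow u b j) (z ^ e) (w ^ d) }) p)
      where
      shift : ∀ w c X F Z W → c * X * F * Z * (w * W) ≡ w * (c * X * F * Z * W)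
      shift = solve-∀

    D-scale : ∀ n j p → D j (scale n p) ≡ + n * D j p
    D-scale n j p = trans (D-map j _ p) (sum-scale _ (∂t j) (+ n)
      (λ { (term c a b e d) → shift (+ n) c (x ^ a) (∂pow u b j) (z ^ e) (w ^ d) }) p)
      where
      shift : ∀ n c X F Z W → n * c * X * F * Z * W ≡ n * (c * X * F * Z * W)
      shift = solve-∀

    D-mulY : ∀ j p → D j (mulY p) ≡ u * D j p + + j * D (j ∸ 1) p
    D-mulY j p = trans (D-map j _ p) (sum-linear _ (∂t j) (∂t (j ∸ 1)) u (+ j) leibniz p)
      where
      expand : ∀ u J c X F F' Z W → c * X * (u * F + J * F') * Z * W ≡ u * (c * X * F * Z * W) + J * (c * X * F' * Z * W)
      expand = solve-∀
      leibniz : ∀ τ → ∂t j (term (coef τ) (ex τ) (suc (ey τ)) (ez τ) (et τ)) ≡ u * ∂t j τ + + j * ∂t (j ∸ 1) τ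
      leibniz (term c a b e d) = trans (cong (λ q → c * x ^ a * q * z ^ e * w ^ d) (∂pow-suc u b j))
        (expand u (+ j) c (x ^ a) (∂pow u b j) (∂pow u b (j ∸ 1)) (z ^ e) (w ^ d))

    D-yDy : ∀ j p → D j (yDy p) ≡ u * D (suc j) p + + j * D j p
    D-yDy j p = trans (D-map j _ p) (sum-linear _ (∂t (suc j)) (∂t j) u (+ j) euler p)
      where
      expand : ∀ u J B c X F F' Z W → B * F ≡ u * F' + J * F →
        B * c * X * F * Z * W ≡ u * (c * X * F' * Z * W) + J * (c * X * F * Z * W)
      expand u J B c X F F' Z W e = trans (move B c X F Z W) (trans (cong (λ q → c * X * q * Z * W) e) (spread u J c X F F' Z W))
        where
        move : ∀ B c X F Z W → B * c * X * F * Z * W ≡ c * X * (B * F) * Z * W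
        move = solve-∀
        spread : ∀ u J c X F F' Z W → c * X * (u * F' + J * F) * Z * W ≡ u * (c * X * F' * Z * W) + J * (c * X * F * Z * W)
        spread = solve-∀
      euler : ∀ τ → ∂t j (term (+ ey τ * coef τ) (ex τ) (ey τ) (ez τ) (et τ)) ≡ u * ∂t (suc j) τ + + j * ∂t j τ
      euler (term c a b e d) = expand u (+ j) (+ b) c (x ^ a) (∂pow u b j) (∂pow u b (suc j)) (z ^ e) (w ^ d) (∂pow-euler u b j)

  -- The j-th y-derivative of  [x + nz + (y+t)(n + (y+1)∂y)] g,  expressed
  -- through prev = g⁽ʲ⁻¹⁾, cur = g⁽ʲ⁾ and next = g⁽ʲ⁺¹⁾.  This operator is
  -- `step n` conjugated by the shift y ↦ y+1, t ↦ t-1 that turns Q into R.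
  stepDeriv : ℕ → ℕ → ℤ → ℤ → ℤ → ℤ → ℤ → ℤ → ℤ → ℤ
  stepDeriv n j x y z t prev cur next =
    (x + + n * z + + n * (y + t) + + j * (y + y + t + 1ℤ)) * cur
      + (+ n * + j + + j * + (j ∸ 1)) * prev + (y + t) * (y + 1ℤ) * next

  module ShiftedStep (x y z t : ℤ) where
    open ∂Calculus x (y + 1ℤ) z (t - 1ℤ)

    inner : ℕ → Poly → Poly
    inner n p = scale n p ++ yDy p

    D-inner : ∀ n k p → D k (inner n p) ≡ + n * D k p + ((y + 1ℤ) * D (suc k) p + + k * D k p)
    D-inner n k p = trans (D-++ k (scale n p) (yDy p)) (cong₂ _+_ (D-scale n k p) (D-yDy k p))

    D-inner-pred : ∀ n j p → + j * D (j ∸ 1) (inner n p)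
      ≡ + j * (+ n * D (j ∸ 1) p + ((y + 1ℤ) * D j p + + (j ∸ 1) * D (j ∸ 1) p))
    D-inner-pred n j p = trans (cong (+ j *_) (D-inner n (j ∸ 1) p))
      (weight-pred-suc (λ k → + n * D (j ∸ 1) p + ((y + 1ℤ) * D k p + + (j ∸ 1) * D (j ∸ 1) p)) j)

    D-step : ∀ n j p → D j (step n p) ≡ stepDeriv n j x y z t (D (j ∸ 1) p) (D j p) (D (suc j) p)
    D-step n j p
      rewrite D-++ j (mulX p) (scale n (mulZ p) ++ mulY (inner n p) ++ mulT (inner n p))
            | D-++ j (scale n (mulZ p)) (mulY (inner n p) ++ mulT (inner n p))
            | D-++ j (mulY (inner n p)) (mulT (inner n p))
            | D-mulX j p | D-scale n j (mulZ p) | D-mulZ j p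
            | D-mulY j (inner n p) | D-mulT j (inner n p)
            | D-inner n j p | D-inner-pred n j p
      = collect x y z t (+ n) (+ j) (+ (j ∸ 1)) (D (j ∸ 1) p) (D j p) (D (suc j) p)
      where
      collect : ∀ x y z t N J J' A B C →
        x * B + (N * (z * B) + ((y + 1ℤ) * (N * B + ((y + 1ℤ) * C + J * B))
          + J * (N * A + ((y + 1ℤ) * B + J' * A)) + (t - 1ℤ) * (N * B + ((y + 1ℤ) * C + J * B))))
        ≡ (x + N * z + N * (y + t) + J * (y + y + t + 1ℤ)) * B + (N * J + J * J') * A + (y + t) * (y + 1ℤ) * C
      collect = solve-∀

  module Monomials (x y z t : ℤ) where
    μ : ℕ → ℕ → ℕ → ℕ → ℕ → ℤ
    μ j A U E I = x ^ A * ∂pow y U j * z ^ E * t ^ I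

    -- Ring-theoretic core of the tree recurrence: given Euler's identity
    -- (at orders j and j-1) and the lowering rule for the derivative values
    -- F = (y^U)⁽ʲ⁾, F₊ = (y^U)⁽ʲ⁺¹⁾, F₋ = (y^U)⁽ʲ⁻¹⁾, G = (y^(U-1))⁽ʲ⁾, the
    -- weighted monomials of the six insertion kinds add up to `stepDeriv`.
    children-sum : ∀ N Uz J J' X Z T F F₊ F₋ G →
      Uz * F ≡ y * F₊ + J * F → J * (Uz * F₋) ≡ J * (y * F + J' * F₋) → Uz * G ≡ F₊ →
      x * X * F * Z * T + (N * (X * F * (z * Z) * T)
        + (N + Uz) * (X * (y * F + J * F₋) * Z * T + X * F * Z * (t * T))
        + Uz * (X * F * Z * T + X * G * Z * (t * T)))
      ≡ (x + N * z + N * (y + t) + J * (y + y + t + 1ℤ)) * (X * F * Z * T)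
        + (N * J + J * J') * (X * F₋ * Z * T) + (y + t) * (y + 1ℤ) * (X * F₊ * Z * T)
    children-sum N Uz J J' X Z T F F₊ F₋ G euler euler-pred lower = begin
      _ ≡⟨ regroup x y z t N Uz J X Z T F F₋ G ⟩
      B₀ + X * Z * T * ((y + t + 1ℤ) * (Uz * F) + J * (Uz * F₋) + t * (Uz * G))
        ≡⟨ cong (λ s → B₀ + X * Z * T * s)
             (cong₂ _+_ (cong₂ _+_ (cong ((y + t + 1ℤ) *_) euler) euler-pred) (cong (t *_) lower)) ⟩
      B₀ + X * Z * T * ((y + t + 1ℤ) * (y * F₊ + J * F) + J * (y * F + J' * F₋) + t * F₊)
        ≡⟨ collect x y z t N J J' X Z T F F₊ F₋ ⟩
      _ ∎
      where
      B₀ = x * X * F * Z * T + N * (X * F * (z * Z) * T) + N * (X * (y * F + J * F₋) * Z * T + X * F * Z * (t * T))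
      regroup : ∀ x y z t N Uz J X Z T F F₋ G →
        x * X * F * Z * T + (N * (X * F * (z * Z) * T)
          + (N + Uz) * (X * (y * F + J * F₋) * Z * T + X * F * Z * (t * T))
          + Uz * (X * F * Z * T + X * G * Z * (t * T)))
        ≡ x * X * F * Z * T + N * (X * F * (z * Z) * T) + N * (X * (y * F + J * F₋) * Z * T + X * F * Z * (t * T))
          + X * Z * T * ((y + t + 1ℤ) * (Uz * F) + J * (Uz * F₋) + t * (Uz * G))
      regroup = solve-∀
      collect : ∀ x y z t N J J' X Z T F F₊ F₋ →
        x * X * F * Z * T + N * (X * F * (z * Z) * T) + N * (X * (y * F + J * F₋) * Z * T + X * F * Z * (t * T))
          + X * Z * T * ((y + t + 1ℤ) * (y * F₊ + J * F) + J * (y * F + J' * F₋) + t * F₊)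
        ≡ (x + N * z + N * (y + t) + J * (y + y + t + 1ℤ)) * (X * F * Z * T)
          + (N * J + J * J') * (X * F₋ * Z * T) + (y + t) * (y + 1ℤ) * (X * F₊ * Z * T)
      collect = solve-∀

    -- The monomials of the trees obtained from one tree with statistics
    -- (A, U, E, I) and n labelled non-root vertices satisfy the recurrence of
    -- the shifted Q: one new root child, n new leaves under labelled vertices,
    -- n + U new parents (unlabelled or labelled), U new leaves under
    -- unlabelled vertices and U relabelled vertices.
    monomial-step : ∀ n j A U E I →
      μ j (suc A) U E I + (+ n * μ j A U (suc E) I
        + (+ n + + U) * (μ j A (suc U) E I + μ j A U E (suc I))
        + + U * (μ j A U E I + μ j A (U ∸ 1) E (suc I)))
      ≡ stepDeriv n j x y z t (μ (j ∸ 1) A U E I) (μ j A U E I) (μ (suc j) A U E I)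
    monomial-step n j A U E I rewrite ∂pow-suc y U j =
      children-sum (+ n) (+ U) (+ j) (+ (j ∸ 1)) (x ^ A) (z ^ E) (t ^ I)
        (∂pow y U j) (∂pow y U (suc j)) (∂pow y U (j ∸ 1)) (∂pow y (U ∸ 1) j)
        (∂pow-euler y U j) (∂pow-euler-pred y U j) (∂pow-lower y U j)


module GregTrees where

  open import Defs
  open import Data.Nat as ℕ using (ℕ; zero; suc; _+_; _≤_; _<_; _⊓_; _≡ᵇ_; _≤ᵇ_; _<ᵇ_; z≤n; s≤s)
  import Data.Nat.Properties as NP
  open import Data.Nat.Tactic.RingSolver using (solve-∀)
  import Data.Nat.ListAction as ℕSum
  import Data.Nat.ListAction.Properties as ℕSumP
  open import Data.Bool using (Bool; true; false; if_then_else_; _∨_; T)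
  open import Data.Maybe using (Maybe; just; nothing)
  import Data.Maybe.Properties as MaybeP
  open import Data.List using (List; []; _∷_; _++_; map; length; foldr; upTo; concatMap)
  import Data.List.Properties as LP
  open import Data.Bool.ListAction using (any)
  open import Data.Product using (_×_; _,_; proj₁; proj₂; ∃)
  open import Data.Sum using (_⊎_; inj₁; inj₂)
  open import Data.Unit using (⊤; tt)
  open import Data.Empty using (⊥; ⊥-elim)
  open import Relation.Nullary using (¬_; yes; no)
  open import Relation.Binary.PropositionalEquality
  open import Function.Bundles using (mk⇔; Equivalence)
  open import Data.List.Relation.Unary.All as All using (All; []; _∷_)
  import Data.List.Relation.Unary.All.Properties as AllP
  open import Data.List.Relation.Unary.Any using (here; there)
  open import Data.List.Membership.Propositional using (_∈_)
  import Data.List.Membership.Propositional.Properties as MP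
  open import Data.List.Relation.Binary.Permutation.Propositional
    using (_↭_; ↭-refl; ↭-sym; ↭-trans; prep; swap; ↭-reflexive)
  import Data.List.Relation.Binary.Permutation.Propositional.Properties as PermP
  open import Data.List.Relation.Binary.Pointwise as PW using (Pointwise; []; _∷_)
  open import Data.List.Relation.Unary.Unique.Propositional using (Unique)
  import Data.List.Relation.Unary.Unique.Propositional.Properties as UniqueP
  open import Data.List.Relation.Unary.AllPairs using (AllPairs; []; _∷_)
  import Data.List.Relation.Unary.AllPairs.Properties as AllPairsP
  open import Data.List.Relation.Binary.Disjoint.Propositional using (Disjoint)

  T-true : ∀ {b} → T b → b ≡ true
  T-true {true} _ = refl

  T-false : ∀ {b} → ¬ T b → b ≡ false
  T-false {true} n = ⊥-elim (n tt)
  T-false {false} _ = refl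

  <ᵇ-true : ∀ {m n} → m < n → (m <ᵇ n) ≡ true
  <ᵇ-true p = T-true (NP.<⇒<ᵇ p)

  <ᵇ-false : ∀ {m n} → n ≤ m → (m <ᵇ n) ≡ false
  <ᵇ-false {m} {n} p = T-false (λ t → NP.<-irrefl refl (NP.<-≤-trans (NP.<ᵇ⇒< m n t) p))

  ≤ᵇ-true : ∀ {m n} → m ≤ n → (m ≤ᵇ n) ≡ true
  ≤ᵇ-true p = T-true (NP.≤⇒≤ᵇ p)

  ≤ᵇ-false : ∀ {m n} → n < m → (m ≤ᵇ n) ≡ false
  ≤ᵇ-false {m} {n} p = T-false (λ t → NP.<-irrefl refl (NP.<-≤-trans p (NP.≤ᵇ⇒≤ m n t)))

  ≡ᵇ-false : ∀ {k N} → k < N → (k ≡ᵇ N) ≡ false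
  ≡ᵇ-false {k} {N} k<N = T-false (λ t → NP.<-irrefl (NP.≡ᵇ⇒≡ k N t) k<N)

  ≡ᵇ-refl : ∀ N → (N ≡ᵇ N) ≡ true
  ≡ᵇ-refl N = T-true (NP.≡⇒≡ᵇ N N refl)

  Δ-addˡ : ∀ a b s t → a ≡ b + t → s + a ≡ (s + b) + t
  Δ-addˡ a b s t e rewrite e = sym (NP.+-assoc s b t)

  Δ-addʳ : ∀ a b s t → a ≡ b + t → a + s ≡ (b + s) + t
  Δ-addʳ a b s t e rewrite e = swap₂ b t s
    where
    swap₂ : ∀ b t s → b + t + s ≡ b + s + t
    swap₂ = solve-∀

  Δ₂-addˡ : ∀ a b s d u → a + d ≡ b + u → (s + a) + d ≡ (s + b) + u
  Δ₂-addˡ a b s d u e = trans (NP.+-assoc s a d) (trans (cong (s +_) e) (sym (NP.+-assoc s b u)))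

  Δ₂-addʳ : ∀ a b s d u → a + d ≡ b + u → (a + s) + d ≡ (b + s) + u
  Δ₂-addʳ a b s d u e = trans (swap₂ a s d) (trans (cong (_+ s) e) (swap₂ b u s))
    where
    swap₂ : ∀ a s d → a + s + d ≡ a + d + s
    swap₂ = solve-∀

  NonEmpty : List ℕ → Set
  NonEmpty [] = ⊥
  NonEmpty (_ ∷ _) = ⊤

  minL-≤ : ∀ xs {y} → y ∈ xs → minL xs ≤ y
  minL-≤ (x ∷ xs) {y} p = go x xs p
    where
    go : ∀ x xs → y ∈ x ∷ xs → foldr _⊓_ x xs ≤ y
    go x [] (here refl) = NP.≤-refl
    go x (a ∷ as) (here refl) = NP.≤-trans (NP.m⊓n≤n a (foldr _⊓_ x as)) (go x as (here refl))
    go x (a ∷ as) (there (here refl)) = NP.m⊓n≤m a _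
    go x (a ∷ as) (there (there q)) = NP.≤-trans (NP.m⊓n≤n a (foldr _⊓_ x as)) (go x as (there q))

  minL-∈ : ∀ xs → NonEmpty xs → minL xs ∈ xs
  minL-∈ (x ∷ xs) _ = go x xs
    where
    go : ∀ x xs → minL (x ∷ xs) ∈ x ∷ xs
    go x [] = here refl
    go x (a ∷ as) with NP.⊓-sel a (foldr _⊓_ x as)
    ... | inj₁ e rewrite e = there (here refl)
    ... | inj₂ e rewrite e with go x as
    ...   | here p = here p
    ...   | there p = there (there p)

  ↭-nonEmpty : ∀ {N xs} ys → ys ↭ N ∷ xs → NonEmpty ys
  ↭-nonEmpty [] p with PermP.↭-length p
  ... | ()
  ↭-nonEmpty (_ ∷ _) p = tt

  -- The minimum is unchanged by adding a larger element; this is why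
  -- inserting the largest label N never changes any β value.
  minL-insert-larger : ∀ {N} xs ys → ys ↭ N ∷ xs → NonEmpty xs → All (_< N) xs → minL ys ≡ minL xs
  minL-insert-larger {N} xs ys p ne lt = NP.≤-antisym ys≤xs xs≤ys
    where
    ys≤xs : minL ys ≤ minL xs
    ys≤xs = minL-≤ ys (PermP.∈-resp-↭ (↭-sym p) (there (minL-∈ xs ne)))
    xs≤ys : minL xs ≤ minL ys
    xs≤ys with PermP.∈-resp-↭ p (minL-∈ ys (↭-nonEmpty ys p))
    ... | there q = minL-≤ xs q
    ... | here e = ⊥-elim (NP.<-irrefl refl (NP.≤-<-trans (subst (_≤ minL xs) e ys≤xs) (All.lookup lt (minL-∈ xs ne))))

  snoc↭ : ∀ (N : ℕ) xs → xs ++ N ∷ [] ↭ N ∷ xs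
  snoc↭ N xs = ↭-trans (PermP.shift N xs []) (prep N (↭-reflexive (LP.++-identityʳ xs)))

  labelsL-++ : ∀ xs ys → labelsL (xs ++ ys) ≡ labelsL xs ++ labelsL ys
  labelsL-++ [] ys = refl
  labelsL-++ (x ∷ xs) ys rewrite labelsL-++ xs ys = sym (LP.++-assoc (labels x) _ _)

  AllLabels : (ℕ → Set) → Tree → Set
  AllLabels P S = All P (labels S)

  All-labelsL : ∀ {P : ℕ → Set} c cs → All P (labelsL (c ∷ cs)) → All P (labels c) × All P (labelsL cs)
  All-labelsL c cs a = AllP.++⁻ˡ (labels c) a , AllP.++⁻ʳ (labels c) a

  All-labels-children : ∀ {P : ℕ → Set} ℓ cs → All P (labels (node ℓ cs)) → All P (labelsL cs)
  All-labels-children nothing cs a = a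
  All-labels-children (just l) cs (_ ∷ a) = a

  All-<⇒≤ : ∀ {N} {xs : List ℕ} → All (_< N) xs → All (_≤ N) xs
  All-<⇒≤ = All.map NP.<⇒≤

  AllNodesL-++ : ∀ {P} xs ys → AllNodesL P xs → AllNodesL P ys → AllNodesL P (xs ++ ys)
  AllNodesL-++ [] ys _ b = b
  AllNodesL-++ (x ∷ xs) ys (a , as) b = a , AllNodesL-++ xs ys as b

  AllNodesL-∈ : ∀ {P c cs} → c ∈ cs → AllNodesL P cs → AllNodes P c
  AllNodesL-∈ {cs = _ ∷ _} (here refl) (a , _) = a
  AllNodesL-∈ {cs = _ ∷ _} (there p) (_ , as) = AllNodesL-∈ p as

  -- Under the degree condition every subtree carries a label (unlabelled
  -- vertices have at least two children), so its β is a genuine minimum.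
  labels-nonEmpty : ∀ S → AllNodes DegreeCond S → NonEmpty (labels S)
  labels-nonEmpty (node (just l) cs) _ = tt
  labels-nonEmpty (node nothing (c ∷ d ∷ cs)) (_ , dc , _) = prefix (labels c) (labels-nonEmpty c dc)
    where
    prefix : ∀ xs {ys} → NonEmpty xs → NonEmpty (xs ++ ys)
    prefix (x ∷ xs) _ = tt
  labels-nonEmpty (node nothing []) (() , _)
  labels-nonEmpty (node nothing (c ∷ [])) (s≤s () , _)

  β-child : ∀ ℓ cs c → c ∈ cs → NonEmpty (labels c) → β (node ℓ cs) ≤ β c
  β-child ℓ cs c c∈ ne = minL-≤ (labels (node ℓ cs)) (sub ℓ (inL cs c∈ (minL-∈ (labels c) ne)))
    where
    inL : ∀ cs {c x} → c ∈ cs → x ∈ labels c → x ∈ labelsL cs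
    inL (c ∷ cs) (here refl) q = MP.∈-++⁺ˡ q
    inL (c ∷ cs) (there p) q = MP.∈-++⁺ʳ (labels c) (inL cs p q)
    sub : ∀ ℓ {x} → x ∈ labelsL cs → x ∈ labels (node ℓ cs)
    sub nothing q = q
    sub (just l) q = there q

  β-children : ∀ ℓ cs → AllNodesL DegreeCond cs → All (λ c → β (node ℓ cs) ≤ β c) cs
  β-children ℓ cs d = All.tabulate (λ {c} c∈ → β-child ℓ cs c c∈ (labels-nonEmpty c (AllNodesL-∈ c∈ d)))

  -- Below N S: S is a subtree of a canonical Greg tree all of whose labels
  -- are smaller than N; this is the situation in which N gets inserted.
  Below : ℕ → Tree → Set
  Below N S = AllNodes DegreeCond S × AllNodes Canonical S × AllLabels (_< N) S

  BelowL : ℕ → List Tree → Set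
  BelowL N cs = AllNodesL DegreeCond cs × AllNodesL Canonical cs × All (_< N) (labelsL cs)

  below-head : ∀ {N c cs} → BelowL N (c ∷ cs) → Below N c
  below-head {c = c} {cs} (d , cn , a) = proj₁ d , proj₁ cn , proj₁ (All-labelsL c cs a)

  below-tail : ∀ {N c cs} → BelowL N (c ∷ cs) → BelowL N cs
  below-tail {c = c} {cs} (d , cn , a) = proj₂ d , proj₂ cn , proj₂ (All-labelsL c cs a)

  below-children : ∀ {N} ℓ cs → Below N (node ℓ cs) → BelowL N cs
  below-children ℓ cs (d , c , a) = proj₂ d , proj₂ c , All-labels-children ℓ cs a

  β<N : ∀ {N} S → AllNodes DegreeCond S → AllLabels (_< N) S → β S < N
  β<N S d a = All.lookup a (minL-∈ (labels S) (labels-nonEmpty S d))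

  βs<N : ∀ {N} cs → AllNodesL DegreeCond cs → All (_< N) (labelsL cs) → All (_< N) (map β cs)
  βs<N [] _ _ = []
  βs<N (c ∷ cs) (d , ds) a = β<N c d (proj₁ (All-labelsL c cs a)) ∷ βs<N cs ds (proj₂ (All-labelsL c cs a))

  inc-snoc : ∀ {N} xs → Increasing xs → All (_< N) xs → Increasing (xs ++ N ∷ [])
  inc-snoc [] _ _ = tt
  inc-snoc (x ∷ []) _ (p ∷ _) = p , tt
  inc-snoc (x ∷ y ∷ xs) (p , i) (_ ∷ a) = p , inc-snoc (y ∷ xs) i a

  inc-tail : ∀ {x} xs → Increasing (x ∷ xs) → Increasing xs
  inc-tail [] _ = tt
  inc-tail (y ∷ xs) (_ , i) = i

  inc-prefix : ∀ xs ys → Increasing (xs ++ ys) → Increasing xs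
  inc-prefix [] ys _ = tt
  inc-prefix (x ∷ []) ys _ = tt
  inc-prefix (x ∷ y ∷ xs) ys (p , i) = p , inc-prefix (y ∷ xs) ys i

  unlL-++ : ∀ xs ys → unlL (xs ++ ys) ≡ unlL xs + unlL ys
  unlL-++ [] ys = refl
  unlL-++ (x ∷ xs) ys rewrite unlL-++ xs ys = sym (NP.+-assoc (unl x) _ _)

  imppL-++ : ∀ xs ys → imppL (xs ++ ys) ≡ imppL xs + imppL ys
  imppL-++ [] ys = refl
  imppL-++ (x ∷ xs) ys rewrite imppL-++ xs ys = sym (NP.+-assoc (impp x) _ _)

  any-snoc : ∀ (p : Tree → Bool) xs y → p y ≡ false → any p (xs ++ y ∷ []) ≡ any p xs
  any-snoc p [] y e rewrite e = refl
  any-snoc p (x ∷ xs) y e rewrite any-snoc p xs y e = refl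

  any-β : ∀ l cs cs' → map β cs' ≡ map β cs → any (λ c → β c <ᵇ l) cs' ≡ any (λ c → β c <ᵇ l) cs
  any-β l [] [] e = refl
  any-β l (c ∷ cs) (c' ∷ cs') e rewrite LP.∷-injectiveˡ e | any-β l cs cs' (LP.∷-injectiveʳ e) = refl

  -- Leading vertices via ancestor contexts.  `lead` walks up the list of
  -- ancestors; we replace that list by the function it induces:
  -- C l b is the β of the top of the greater ancestors path of a vertex
  -- with label l whose own β is b.  Contexts make `lead` compositional.
  Ctx : Set
  Ctx = ℕ → ℕ → ℕ

  extend : Ctx → Maybe ℕ → ℕ → Ctx
  extend C nothing B l b = C l B
  extend C (just k) B l b = if l ≤ᵇ k then C l B else b

  mutual
    leadC : Ctx → Tree → ℕ
    leadC C (node nothing cs) = leadCL (extend C nothing (β (node nothing cs))) cs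
    leadC C (node (just l) cs) =
      (if C l (β (node (just l) cs)) ≡ᵇ l then 1 else 0) + leadCL (extend C (just l) (β (node (just l) cs))) cs

    leadCL : Ctx → List Tree → ℕ
    leadCL C [] = 0
    leadCL C (c ∷ cs) = leadC C c + leadCL C cs

  mutual
    gapβ : ℕ → ℕ → List Tree → ℕ
    gapβ l b [] = b
    gapβ l b (a ∷ as) = gapβ-at l b (label a) (β a) as

    gapβ-at : ℕ → ℕ → Maybe ℕ → ℕ → List Tree → ℕ
    gapβ-at l b nothing βa as = gapβ l βa as
    gapβ-at l b (just k) βa as = if l ≤ᵇ k then gapβ l βa as else b

  ctxOf : List Tree → Ctx
  ctxOf anc l b = gapβ l b anc

  gapTop-β : ∀ l v anc → β (gapTop l v anc) ≡ gapβ l (β v) anc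
  gapTop-β l v [] = refl
  gapTop-β l v (node nothing cs ∷ as) = gapTop-β l (node nothing cs) as
  gapTop-β l v (node (just k) cs ∷ as) with l ≤ᵇ k
  ... | true = gapTop-β l (node (just k) cs) as
  ... | false = refl

  mutual
    leadT-ctx : ∀ anc S → leadT anc S ≡ leadC (ctxOf anc) S
    leadT-ctx anc (node nothing cs) = leadL-ctx (node nothing cs ∷ anc) cs
    leadT-ctx anc (node (just l) cs) rewrite gapTop-β l (node (just l) cs) anc =
      cong ((if gapβ l (β (node (just l) cs)) anc ≡ᵇ l then 1 else 0) +_) (leadL-ctx (node (just l) cs ∷ anc) cs)

    leadL-ctx : ∀ anc cs → leadL anc cs ≡ leadCL (ctxOf anc) cs
    leadL-ctx anc [] = refl
    leadL-ctx anc (c ∷ cs) = cong₂ _+_ (leadT-ctx anc c) (leadL-ctx anc cs)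

  rootCtx : Ctx
  rootCtx l b = b

  lead-ctx : ∀ T → lead T ≡ leadC rootCtx T
  lead-ctx T = leadT-ctx [] T

  leadCL-++ : ∀ C xs ys → leadCL C (xs ++ ys) ≡ leadCL C xs + leadCL C ys
  leadCL-++ C [] ys = refl
  leadCL-++ C (x ∷ xs) ys rewrite leadCL-++ C xs ys = sym (NP.+-assoc (leadC C x) _ _)

  leadingBit : Ctx → Maybe ℕ → ℕ → ℕ
  leadingBit C nothing B = 0
  leadingBit C (just l) B = if C l B ≡ᵇ l then 1 else 0

  leadC-node : ∀ C ℓ cs {B} → β (node ℓ cs) ≡ B → leadC C (node ℓ cs) ≡ leadingBit C ℓ B + leadCL (extend C ℓ B) cs
  leadC-node C nothing cs e = cong (λ b → leadCL (extend C nothing b) cs) e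
  leadC-node C (just l) cs e = cong (λ b → (if C l b ≡ᵇ l then 1 else 0) + leadCL (extend C (just l) b) cs) e

  -- Contexts agreeing on all labels ≤ N give the same count on subtrees
  -- with labels ≤ N: inserting a parent N above S does not affect S.
  _≈⟨_⟩_ : Ctx → ℕ → Ctx → Set
  C ≈⟨ N ⟩ C' = ∀ l b → l ≤ N → C l b ≡ C' l b

  extend-≈ : ∀ {C C' N} ℓ B → (∀ l → l ≤ N → C l B ≡ C' l B) → extend C ℓ B ≈⟨ N ⟩ extend C' ℓ B
  extend-≈ nothing B e l b l≤ = e l l≤
  extend-≈ (just k) B e l b l≤ with l ≤ᵇ k
  ... | true = e l l≤
  ... | false = refl

  mutual
    leadC-cong₁ : ∀ {C C' N} S → (∀ l → l ≤ N → C l (β S) ≡ C' l (β S)) → AllLabels (_≤ N) S → leadC C S ≡ leadC C' S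
    leadC-cong₁ {C} {C'} {N} (node nothing cs) e a = leadCL-cong cs (extend-≈ {C} {C'} {N} nothing (β (node nothing cs)) e) a
    leadC-cong₁ {C} {C'} {N} (node (just l) cs) e (l≤ ∷ a) rewrite e l l≤ =
      cong ((if C' l (β (node (just l) cs)) ≡ᵇ l then 1 else 0) +_)
        (leadCL-cong cs (extend-≈ {C} {C'} {N} (just l) (β (node (just l) cs)) e) a)

    leadCL-cong : ∀ {C C' N} cs → C ≈⟨ N ⟩ C' → All (_≤ N) (labelsL cs) → leadCL C cs ≡ leadCL C' cs
    leadCL-cong [] e a = refl
    leadCL-cong (c ∷ cs) e a =
      cong₂ _+_ (leadC-cong₁ c (λ l l≤ → e l _ l≤) (proj₁ (All-labelsL c cs a))) (leadCL-cong cs e (proj₂ (All-labelsL c cs a)))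

  CtxBounded : Ctx → ℕ → Set
  CtxBounded C B = ∀ l b → B ≤ b → C l b ≤ b

  extend-bounded : ∀ {C B} ℓ → CtxBounded C B → CtxBounded (extend C ℓ B) B
  extend-bounded nothing v l b B≤ = NP.≤-trans (v l _ NP.≤-refl) B≤
  extend-bounded (just k) v l b B≤ with l ≤ᵇ k
  ... | true = NP.≤-trans (v l _ NP.≤-refl) B≤
  ... | false = NP.≤-refl

  bounded-mono : ∀ {C B B'} → CtxBounded C B → B ≤ B' → CtxBounded C B'
  bounded-mono v le l b B'≤ = v l b (NP.≤-trans le B'≤)

  rootCtx-bounded : ∀ B → CtxBounded rootCtx B
  rootCtx-bounded B l b _ = NP.≤-refl

  new-label-not-leading : ∀ {C B N} → CtxBounded C B → B < N → (C N B ≡ᵇ N) ≡ false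
  new-label-not-leading {C} {B} {N} v B<N = ≡ᵇ-false (NP.≤-<-trans (v N B NP.≤-refl) B<N)

  -- Every Greg tree of
  -- size N arises in exactly one way from one of size N-1 by one of:
  --   rootLeaf   a leaf N below the root,
  --   labLeaf    a leaf N below another labelled vertex,
  --   unlLeaf    a leaf N below an unlabelled vertex,
  --   relabel    labelling an unlabelled vertex by N,
  --   unlParent  a new unlabelled vertex subdividing the edge above a
  --              subtree S, with S and a leaf N as its children,
  --   labParent  a new vertex N subdividing the edge above a subtree S.
  -- Since N is larger than all labels and every β value is a smallest
  -- label, new children can always be appended at the end (canonical order).
  leafN : ℕ → Tree
  leafN N = node (just N) []

  hereK : ℕ → Maybe ℕ → List Tree → List Tree
  hereK N (just l) cs = node (just l) (cs ++ leafN N ∷ []) ∷ []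
  hereK N nothing cs = node nothing (cs ++ leafN N ∷ []) ∷ node (just N) cs ∷ []

  hereS : ℕ → Maybe ℕ → List Tree → List Tree
  hereS N ℓ cs = node nothing (node ℓ cs ∷ leafN N ∷ []) ∷ node (just N) (node ℓ cs ∷ []) ∷ hereK N ℓ cs

  mutual
    insS : ℕ → Tree → List Tree
    insS N (node ℓ cs) = hereS N ℓ cs ++ map (node ℓ) (insL N cs)

    insL : ℕ → List Tree → List (List Tree)
    insL N [] = []
    insL N (c ∷ cs) = map (_∷ cs) (insS N c) ++ map (c ∷_) (insL N cs)

  insT : ℕ → Tree → List Tree
  insT N (node ℓ cs) = node ℓ (cs ++ leafN N ∷ []) ∷ map (node ℓ) (insL N cs)

  data Kind : Set where
    rootLeaf labLeaf unlParent labParent unlLeaf relabel : Kind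

  kindsK : Maybe ℕ → List Kind
  kindsK (just _) = labLeaf ∷ []
  kindsK nothing = unlLeaf ∷ relabel ∷ []

  mutual
    kindsS : Tree → List Kind
    kindsS (node ℓ cs) = unlParent ∷ labParent ∷ kindsK ℓ ++ kindsL cs

    kindsL : List Tree → List Kind
    kindsL [] = []
    kindsL (c ∷ cs) = kindsS c ++ kindsL cs

  kindsT : Tree → List Kind
  kindsT (node ℓ cs) = rootLeaf ∷ kindsL cs

  unl⁺ unl⁻ impp⁺ lead⁺ deg⁺ : Kind → ℕ
  unl⁺ unlParent = 1
  unl⁺ _ = 0
  unl⁻ relabel = 1
  unl⁻ _ = 0
  impp⁺ labParent = 1
  impp⁺ relabel = 1
  impp⁺ _ = 0
  lead⁺ rootLeaf = 1
  lead⁺ labLeaf = 1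
  lead⁺ _ = 0
  deg⁺ rootLeaf = 1
  deg⁺ _ = 0

  Δdeg≤Δlead : ∀ κ → deg⁺ κ ≤ lead⁺ κ
  Δdeg≤Δlead rootLeaf = NP.≤-refl
  Δdeg≤Δlead labLeaf = z≤n
  Δdeg≤Δlead unlParent = z≤n
  Δdeg≤Δlead labParent = z≤n
  Δdeg≤Δlead unlLeaf = z≤n
  Δdeg≤Δlead relabel = z≤n

  -- Removal of the label N, inverse to insertion: a vertex N is deleted
  -- (or unlabelled, if it keeps at least two children) and an unlabelled
  -- vertex left with one child is suppressed.
  consM : Maybe Tree → List Tree → List Tree
  consM nothing ys = ys
  consM (just y) ys = y ∷ ys

  suppress : List Tree → Tree
  suppress [] = node nothing []
  suppress (c ∷ []) = c
  suppress (c ∷ d ∷ r) = node nothing (c ∷ d ∷ r)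

  dropN : List Tree → Maybe Tree
  dropN [] = nothing
  dropN (c ∷ []) = just c
  dropN (c ∷ d ∷ r) = just (node nothing (c ∷ d ∷ r))

  mutual
    rmS : ℕ → Tree → Maybe Tree
    rmS N (node nothing cs) = just (suppress (rmL N cs))
    rmS N (node (just k) cs) = if k ≡ᵇ N then dropN (rmL N cs) else just (node (just k) (rmL N cs))

    rmL : ℕ → List Tree → List Tree
    rmL N [] = []
    rmL N (c ∷ cs) = consM (rmS N c) (rmL N cs)

  rmT : ℕ → Tree → Tree
  rmT N (node ℓ cs) = node ℓ (rmL N cs)

  suppress-2 : ∀ cs → 2 ≤ length cs → suppress cs ≡ node nothing cs
  suppress-2 (c ∷ d ∷ r) _ = refl
  suppress-2 [] ()
  suppress-2 (c ∷ []) (s≤s ())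

  dropN-2 : ∀ cs → 2 ≤ length cs → dropN cs ≡ just (node nothing cs)
  dropN-2 (c ∷ d ∷ r) _ = refl
  dropN-2 [] ()
  dropN-2 (c ∷ []) (s≤s ())

  mutual
    rm-id : ∀ N S → AllNodes DegreeCond S → AllLabels (_< N) S → rmS N S ≡ just S
    rm-id N (node nothing (c ∷ d ∷ r)) (_ , dc , dd , dr) a
      rewrite rm-id N c dc (proj₁ (All-labelsL c (d ∷ r) a))
            | rm-id N d dd (proj₁ (All-labelsL d r (proj₂ (All-labelsL c (d ∷ r) a))))
            | rmL-id N r dr (proj₂ (All-labelsL d r (proj₂ (All-labelsL c (d ∷ r) a)))) = refl
    rm-id N (node nothing []) (() , _) a
    rm-id N (node nothing (c ∷ [])) (s≤s () , _) a
    rm-id N (node (just k) cs) (_ , dcs) (k<N ∷ a) rewrite ≡ᵇ-false k<N | rmL-id N cs dcs a = refl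

    rmL-id : ∀ N cs → AllNodesL DegreeCond cs → All (_< N) (labelsL cs) → rmL N cs ≡ cs
    rmL-id N [] _ _ = refl
    rmL-id N (c ∷ cs) (dc , dcs) a
      rewrite rm-id N c dc (proj₁ (All-labelsL c cs a)) | rmL-id N cs dcs (proj₂ (All-labelsL c cs a)) = refl

  rmL-++ : ∀ N xs ys → rmL N (xs ++ ys) ≡ rmL N xs ++ rmL N ys
  rmL-++ N [] ys = refl
  rmL-++ N (x ∷ xs) ys with rmS N x
  ... | nothing = rmL-++ N xs ys
  ... | just y = cong (y ∷_) (rmL-++ N xs ys)

  pointwise-mapˡ : ∀ {A A' B : Set} {R : A → B → Set} {S : A' → B → Set} (f : A → A') {xs ys} →
    (∀ {a b} → R a b → S (f a) b) → Pointwise R xs ys → Pointwise S (map f xs) ys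
  pointwise-mapˡ f g [] = []
  pointwise-mapˡ f g (r ∷ rs) = g r ∷ pointwise-mapˡ f g rs

  pointwise-All : ∀ {A B : Set} {R : A → B → Set} {P : A → Set} {xs ys} → (∀ {x y} → R x y → P x) → Pointwise R xs ys → All P xs
  pointwise-All f [] = []
  pointwise-All f (r ∷ rs) = f r ∷ pointwise-All f rs

  pointwise-lookup : ∀ {A B : Set} {R : A → B → Set} {xs ys x} → Pointwise R xs ys → x ∈ xs → ∃ λ y → R x y
  pointwise-lookup (r ∷ rs) (here refl) = _ , r
  pointwise-lookup (r ∷ rs) (there p) = pointwise-lookup rs p

  record SubtreeInsertion (N : ℕ) (C : Ctx) (S S' : Tree) (κ : Kind) : Set where
    field
      labelsE : labels S' ↭ N ∷ labels S
      βeq : β S' ≡ β S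
      unlE : unl S' + unl⁻ κ ≡ unl S + unl⁺ κ
      impE : impp S' ≡ impp S + impp⁺ κ
      leadE : leadC C S' ≡ leadC C S + lead⁺ κ
      degreeOK : AllNodes DegreeCond S'
      canonicalOK : AllNodes Canonical S'
      removes : rmS N S' ≡ just S
      noRootChild : deg⁺ κ ≡ 0

  record ForestInsertion (N : ℕ) (C : Ctx) (cs cs' : List Tree) (κ : Kind) : Set where
    field
      labelsE : labelsL cs' ↭ N ∷ labelsL cs
      βs : map β cs' ≡ map β cs
      unlE : unlL cs' + unl⁻ κ ≡ unlL cs + unl⁺ κ
      impE : imppL cs' ≡ imppL cs + impp⁺ κ
      leadE : leadCL C cs' ≡ leadCL C cs + lead⁺ κ
      degreeOK : AllNodesL DegreeCond cs'
      canonicalOK : AllNodesL Canonical cs'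
      removes : rmL N cs' ≡ cs
      noRootChild : deg⁺ κ ≡ 0

  record TreeInsertion (N : ℕ) (T T' : Tree) (κ : Kind) : Set where
    field
      labelsE : labels T' ↭ N ∷ labels T
      degE : degRoot T' ≡ degRoot T + deg⁺ κ
      unlE : unl T' + unl⁻ κ ≡ unl T + unl⁺ κ
      impE : impp T' ≡ impp T + impp⁺ κ
      leadE : lead T' ≡ lead T + lead⁺ κ
      degreeOK : AllNodes DegreeCond T'
      canonicalOK : AllNodes Canonical T'
      removes : rmT N T' ≡ T
      sameRoot : label T' ≡ label T

  -- The ancestor context is required to be bounded by the β of the
  -- subtree, so that the new vertex N is never leading unless it is a leaf
  -- below a labelled vertex (kinds rootLeaf and labLeaf).
  module InsertionFacts (N : ℕ) where

    ins-unlParent : ∀ C S → Below N S → CtxBounded C (β S) →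
      SubtreeInsertion N C S (node nothing (S ∷ leafN N ∷ [])) unlParent
    ins-unlParent C S (d , c , a) v = record
      { labelsE = labels↭ ; βeq = β≡
      ; unlE = trans (NP.+-identityʳ _) (trans (cong suc (NP.+-identityʳ (unl S))) (NP.+-comm 1 (unl S)))
      ; impE = refl
      ; leadE = trans (leadC-node C nothing (S ∷ leafN N ∷ []) β≡)
          (cong₂ _+_ (leadC-cong₁ {N = N} S (λ l _ → refl) (All-<⇒≤ a))
            (cong (λ q → (if q then 1 else 0) + 0 + 0) (new-label-not-leading v (β<N S d a))))
      ; degreeOK = s≤s (s≤s z≤n) , d , (tt , tt) , tt
      ; canonicalOK = (β<N S d a , tt) , c , (tt , tt) , tt
      ; removes = removes ; noRootChild = refl }
      where
      labels↭ : labels S ++ N ∷ [] ↭ N ∷ labels S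
      labels↭ = snoc↭ N (labels S)
      β≡ : β (node nothing (S ∷ leafN N ∷ [])) ≡ β S
      β≡ = minL-insert-larger (labels S) _ labels↭ (labels-nonEmpty S d) a
      removes : rmS N (node nothing (S ∷ leafN N ∷ [])) ≡ just S
      removes rewrite rm-id N S d a | ≡ᵇ-refl N = refl

    ins-labParent : ∀ C S → Below N S → CtxBounded C (β S) →
      SubtreeInsertion N C S (node (just N) (S ∷ [])) labParent
    ins-labParent C S (d , c , a) v = record
      { labelsE = labels↭ ; βeq = β≡
      ; unlE = cong (_+ 0) (NP.+-identityʳ (unl S))
      ; impE = trans (cong (λ q → (if q ∨ false then 1 else 0) + (impp S + 0)) (<ᵇ-true (β<N S d a)))
                 (trans (cong suc (NP.+-identityʳ (impp S))) (NP.+-comm 1 (impp S)))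
      ; leadE = trans (leadC-node C (just N) (S ∷ []) β≡)
          (trans (cong (λ q → (if q then 1 else 0) + (leadC (extend C (just N) (β S)) S + 0)) (new-label-not-leading v (β<N S d a)))
            (cong (_+ 0) (leadC-cong₁ {N = N} S (λ l l≤ → cong (λ q → if q then C l (β S) else β S) (≤ᵇ-true l≤)) (All-<⇒≤ a))))
      ; degreeOK = tt , d , tt
      ; canonicalOK = tt , c , tt
      ; removes = removes ; noRootChild = refl }
      where
      labels↭ : N ∷ labels S ++ [] ↭ N ∷ labels S
      labels↭ = prep N (↭-reflexive (LP.++-identityʳ _))
      β≡ : β (node (just N) (S ∷ [])) ≡ β S
      β≡ = minL-insert-larger (labels S) _ labels↭ (labels-nonEmpty S d) a
      removes : rmS N (node (just N) (S ∷ [])) ≡ just S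
      removes rewrite ≡ᵇ-refl N | rm-id N S d a = refl

    snoc-leaf-ok : ∀ cs → BelowL N cs → Increasing (map β cs) →
      AllNodesL DegreeCond (cs ++ leafN N ∷ []) × Increasing (map β (cs ++ leafN N ∷ [])) × AllNodesL Canonical (cs ++ leafN N ∷ [])
    snoc-leaf-ok cs (d , c , a) inc =
        AllNodesL-++ cs _ d ((tt , tt) , tt)
      , subst Increasing (sym (LP.map-++ β cs (leafN N ∷ []))) (inc-snoc (map β cs) inc (βs<N cs d a))
      , AllNodesL-++ cs _ c ((tt , tt) , tt)

    rm-snoc-leaf : ∀ cs → BelowL N cs → rmL N (cs ++ leafN N ∷ []) ≡ cs
    rm-snoc-leaf cs (d , _ , a) rewrite rmL-++ N cs (leafN N ∷ []) | ≡ᵇ-refl N | rmL-id N cs d a = LP.++-identityʳ cs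

    labelsL-snoc : ∀ cs → labelsL (cs ++ leafN N ∷ []) ↭ N ∷ labelsL cs
    labelsL-snoc cs = ↭-trans (↭-reflexive (labelsL-++ cs (leafN N ∷ []))) (snoc↭ N (labelsL cs))

    -- kind labLeaf: a new leaf N below the labelled vertex l < N; the leaf is
    -- leading, since its greater ancestors path is the leaf itself
    ins-labLeaf : ∀ C l cs → Below N (node (just l) cs) → CtxBounded C (β (node (just l) cs)) →
      SubtreeInsertion N C (node (just l) cs) (node (just l) (cs ++ leafN N ∷ [])) labLeaf
    ins-labLeaf C l cs (d , c , (l<N ∷ a)) v = record
      { labelsE = labels↭ ; βeq = β≡
      ; unlE = cong (_+ 0) (trans (unlL-++ cs (leafN N ∷ [])) (NP.+-identityʳ _))
      ; impE = trans (cong₂ (λ p q → (if p then 1 else 0) + q) (any-snoc _ cs (leafN N) (<ᵇ-false (NP.<⇒≤ l<N)))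
                            (trans (imppL-++ cs (leafN N ∷ [])) (NP.+-identityʳ _)))
                     (sym (NP.+-identityʳ _))
      ; leadE = trans (leadC-node C (just l) (cs ++ leafN N ∷ []) β≡)
          (trans (cong (leadingBit C (just l) B +_)
                   (trans (leadCL-++ (extend C (just l) B) cs (leafN N ∷ [])) (cong (leadCL (extend C (just l) B) cs +_) leaf-leading)))
            (sym (NP.+-assoc (leadingBit C (just l) B) (leadCL (extend C (just l) B) cs) 1)))
      ; degreeOK = tt , proj₁ valid
      ; canonicalOK = proj₁ (proj₂ valid) , proj₂ (proj₂ valid)
      ; removes = removes ; noRootChild = refl }
      where
      B = β (node (just l) cs)
      valid = snoc-leaf-ok cs (proj₂ d , proj₂ c , a) (proj₁ c)
      leaf-leading : leadCL (extend C (just l) B) (leafN N ∷ []) ≡ 1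
      leaf-leading rewrite ≤ᵇ-false l<N | ≡ᵇ-refl N = refl
      labels↭ : l ∷ labelsL (cs ++ leafN N ∷ []) ↭ N ∷ l ∷ labelsL cs
      labels↭ = ↭-trans (prep l (labelsL-snoc cs)) (swap l N ↭-refl)
      β≡ : β (node (just l) (cs ++ leafN N ∷ [])) ≡ β (node (just l) cs)
      β≡ = minL-insert-larger (l ∷ labelsL cs) _ labels↭ tt (l<N ∷ a)
      removes : rmS N (node (just l) (cs ++ leafN N ∷ [])) ≡ just (node (just l) cs)
      removes rewrite ≡ᵇ-false l<N | rm-snoc-leaf cs (proj₂ d , proj₂ c , a) = refl

    ins-unlLeaf : ∀ C cs → Below N (node nothing cs) → CtxBounded C (β (node nothing cs)) →
      SubtreeInsertion N C (node nothing cs) (node nothing (cs ++ leafN N ∷ [])) unlLeaf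
    ins-unlLeaf C cs (d , c , a) v = record
      { labelsE = labelsL-snoc cs ; βeq = β≡
      ; unlE = cong (λ q → suc q + 0) (trans (unlL-++ cs (leafN N ∷ [])) (NP.+-identityʳ _))
      ; impE = imppL-++ cs (leafN N ∷ [])
      ; leadE = trans (leadC-node C nothing (cs ++ leafN N ∷ []) β≡)
          (trans (leadCL-++ (extend C nothing B) cs (leafN N ∷ [])) (cong (leadCL (extend C nothing B) cs +_) leaf-not-leading))
      ; degreeOK = NP.≤-trans (proj₁ d) (subst (length cs ≤_) (sym (LP.length-++ cs)) (NP.m≤m+n _ _)) , proj₁ valid
      ; canonicalOK = proj₁ (proj₂ valid) , proj₂ (proj₂ valid)
      ; removes = cong just (trans (cong suppress (rm-snoc-leaf cs (proj₂ d , proj₂ c , a))) (suppress-2 cs (proj₁ d)))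
      ; noRootChild = refl }
      where
      B = β (node nothing cs)
      valid = snoc-leaf-ok cs (proj₂ d , proj₂ c , a) (proj₁ c)
      leaf-not-leading : leadCL (extend C nothing B) (leafN N ∷ []) ≡ 0
      leaf-not-leading rewrite new-label-not-leading v (β<N (node nothing cs) d a) = refl
      β≡ : β (node nothing (cs ++ leafN N ∷ [])) ≡ β (node nothing cs)
      β≡ = minL-insert-larger (labelsL cs) _ (labelsL-snoc cs) (labels-nonEmpty (node nothing cs) d) a

    -- kind relabel: an unlabelled vertex receives the label N; it becomes an
    -- improper parent (its children have smaller β) but is not leading
    ins-relabel : ∀ C cs → Below N (node nothing cs) → CtxBounded C (β (node nothing cs)) →
      SubtreeInsertion N C (node nothing cs) (node (just N) cs) relabel
    ins-relabel C cs (d , c , a) v = record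
      { labelsE = ↭-refl ; βeq = β≡
      ; unlE = trans (NP.+-comm (unlL cs) 1) (sym (NP.+-identityʳ _))
      ; impE = trans (cong (λ q → (if q then 1 else 0) + imppL cs) (improper cs (proj₁ d) (proj₂ d) a)) (NP.+-comm 1 (imppL cs))
      ; leadE = trans (leadC-node C (just N) cs β≡)
          (trans (cong (λ q → (if q then 1 else 0) + leadCL (extend C (just N) B) cs) (new-label-not-leading v (β<N (node nothing cs) d a)))
            (trans (leadCL-cong {N = N} cs (λ l b l≤ → cong (λ q → if q then C l B else b) (≤ᵇ-true l≤)) (All-<⇒≤ a))
              (sym (NP.+-identityʳ _))))
      ; degreeOK = tt , proj₂ d
      ; canonicalOK = proj₁ c , proj₂ c
      ; removes = removes ; noRootChild = refl }
      where
      B = β (node nothing cs)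
      β≡ : β (node (just N) cs) ≡ β (node nothing cs)
      β≡ = minL-insert-larger (labelsL cs) _ ↭-refl (labels-nonEmpty (node nothing cs) d) a
      improper : ∀ cs → 2 ≤ length cs → AllNodesL DegreeCond cs → All (_< N) (labelsL cs) → any (λ c → β c <ᵇ N) cs ≡ true
      improper (c ∷ cs) _ (dc , _) a rewrite <ᵇ-true (β<N c dc (proj₁ (All-labelsL c cs a))) = refl
      removes : rmS N (node (just N) cs) ≡ just (node nothing cs)
      removes rewrite ≡ᵇ-refl N | rmL-id N cs (proj₂ d) a = dropN-2 cs (proj₁ d)

    ins-below : ∀ C ℓ cs cs' κ → Below N (node ℓ cs) → ForestInsertion N (extend C ℓ (β (node ℓ cs))) cs cs' κ →
      SubtreeInsertion N C (node ℓ cs) (node ℓ cs') κ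
    ins-below C nothing cs cs' κ (d , c , a) r = record
      { labelsE = ForestInsertion.labelsE r ; βeq = β≡
      ; unlE = cong suc (ForestInsertion.unlE r)
      ; impE = ForestInsertion.impE r
      ; leadE = trans (leadC-node C nothing cs' β≡) (ForestInsertion.leadE r)
      ; degreeOK = subst (2 ≤_) (sym length≡) (proj₁ d) , ForestInsertion.degreeOK r
      ; canonicalOK = subst Increasing (sym (ForestInsertion.βs r)) (proj₁ c) , ForestInsertion.canonicalOK r
      ; removes = cong just (trans (cong suppress (ForestInsertion.removes r)) (suppress-2 cs (proj₁ d)))
      ; noRootChild = ForestInsertion.noRootChild r }
      where
      β≡ : β (node nothing cs') ≡ β (node nothing cs)
      β≡ = minL-insert-larger (labelsL cs) _ (ForestInsertion.labelsE r) (labels-nonEmpty (node nothing cs) d) a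
      length≡ : length cs' ≡ length cs
      length≡ = trans (sym (LP.length-map β cs')) (trans (cong length (ForestInsertion.βs r)) (LP.length-map β cs))
    ins-below C (just l) cs cs' κ (d , c , (l<N ∷ a)) r = record
      { labelsE = labels↭ ; βeq = β≡
      ; unlE = ForestInsertion.unlE r
      ; impE = trans (cong (λ q → (if q then 1 else 0) + imppL cs') (any-β l cs cs' (ForestInsertion.βs r)))
                 (Δ-addˡ (imppL cs') (imppL cs) (if any (λ c → β c <ᵇ l) cs then 1 else 0) (impp⁺ κ) (ForestInsertion.impE r))
      ; leadE = trans (leadC-node C (just l) cs' β≡)
                  (Δ-addˡ _ _ (leadingBit C (just l) (β (node (just l) cs))) (lead⁺ κ) (ForestInsertion.leadE r))
      ; degreeOK = tt , ForestInsertion.degreeOK r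
      ; canonicalOK = subst Increasing (sym (ForestInsertion.βs r)) (proj₁ c) , ForestInsertion.canonicalOK r
      ; removes = removes ; noRootChild = ForestInsertion.noRootChild r }
      where
      labels↭ : l ∷ labelsL cs' ↭ N ∷ l ∷ labelsL cs
      labels↭ = ↭-trans (prep l (ForestInsertion.labelsE r)) (swap l N ↭-refl)
      β≡ : β (node (just l) cs') ≡ β (node (just l) cs)
      β≡ = minL-insert-larger (l ∷ labelsL cs) _ labels↭ tt (l<N ∷ a)
      removes : rmS N (node (just l) cs') ≡ just (node (just l) cs)
      removes rewrite ≡ᵇ-false l<N | ForestInsertion.removes r = refl

    ins-head : ∀ C c c' cs κ → BelowL N cs → SubtreeInsertion N C c c' κ → ForestInsertion N C (c ∷ cs) (c' ∷ cs) κ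
    ins-head C c c' cs κ (d , cn , a) r = record
      { labelsE = PermP.++⁺ʳ (labelsL cs) (SubtreeInsertion.labelsE r)
      ; βs = cong (_∷ map β cs) (SubtreeInsertion.βeq r)
      ; unlE = Δ₂-addʳ _ _ (unlL cs) (unl⁻ κ) (unl⁺ κ) (SubtreeInsertion.unlE r)
      ; impE = Δ-addʳ _ _ (imppL cs) (impp⁺ κ) (SubtreeInsertion.impE r)
      ; leadE = Δ-addʳ _ _ (leadCL C cs) (lead⁺ κ) (SubtreeInsertion.leadE r)
      ; degreeOK = SubtreeInsertion.degreeOK r , d
      ; canonicalOK = SubtreeInsertion.canonicalOK r , cn
      ; removes = removes ; noRootChild = SubtreeInsertion.noRootChild r }
      where
      removes : rmL N (c' ∷ cs) ≡ c ∷ cs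
      removes rewrite SubtreeInsertion.removes r | rmL-id N cs d a = refl

    ins-tail : ∀ C c cs cs' κ → Below N c → ForestInsertion N C cs cs' κ → ForestInsertion N C (c ∷ cs) (c ∷ cs') κ
    ins-tail C c cs cs' κ (d , cn , a) r = record
      { labelsE = ↭-trans (PermP.++⁺ˡ (labels c) (ForestInsertion.labelsE r)) (PermP.shift N (labels c) (labelsL cs))
      ; βs = cong (β c ∷_) (ForestInsertion.βs r)
      ; unlE = Δ₂-addˡ _ _ (unl c) (unl⁻ κ) (unl⁺ κ) (ForestInsertion.unlE r)
      ; impE = Δ-addˡ _ _ (impp c) (impp⁺ κ) (ForestInsertion.impE r)
      ; leadE = Δ-addˡ _ _ (leadC C c) (lead⁺ κ) (ForestInsertion.leadE r)
      ; degreeOK = d , ForestInsertion.degreeOK r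
      ; canonicalOK = cn , ForestInsertion.canonicalOK r
      ; removes = removes ; noRootChild = ForestInsertion.noRootChild r }
      where
      removes : rmL N (c ∷ cs') ≡ c ∷ cs
      removes rewrite rm-id N c d a | ForestInsertion.removes r = refl

    ins-here : ∀ C ℓ cs → Below N (node ℓ cs) → CtxBounded C (β (node ℓ cs)) →
      Pointwise (SubtreeInsertion N C (node ℓ cs)) (hereS N ℓ cs) (unlParent ∷ labParent ∷ kindsK ℓ)
    ins-here C (just l) cs h v = ins-unlParent C _ h v ∷ ins-labParent C _ h v ∷ ins-labLeaf C l cs h v ∷ []
    ins-here C nothing cs h v = ins-unlParent C _ h v ∷ ins-labParent C _ h v ∷ ins-unlLeaf C cs h v ∷ ins-relabel C cs h v ∷ []

    mutual
      insS-facts : ∀ C S → Below N S → CtxBounded C (β S) → Pointwise (SubtreeInsertion N C S) (insS N S) (kindsS S)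
      insS-facts C (node ℓ cs) h v =
        PW.++⁺ (ins-here C ℓ cs h v)
          (pointwise-mapˡ (node ℓ) (λ {cs'} {κ} r → ins-below C ℓ cs cs' κ h r)
            (insL-facts (extend C ℓ (β (node ℓ cs))) (β (node ℓ cs)) cs (below-children ℓ cs h)
              (extend-bounded ℓ v) (β-children ℓ cs (proj₂ (proj₁ h)))))

      insL-facts : ∀ C B cs → BelowL N cs → CtxBounded C B → All (λ c → B ≤ β c) cs →
        Pointwise (ForestInsertion N C cs) (insL N cs) (kindsL cs)
      insL-facts C B [] h v _ = []
      insL-facts C B (c ∷ cs) h v (b≤ ∷ bs) =
        PW.++⁺ (pointwise-mapˡ (_∷ cs) (λ {c'} {κ} r → ins-head C c c' cs κ (below-tail h) r)
                  (insS-facts C c (below-head h) (bounded-mono v b≤)))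
               (pointwise-mapˡ (c ∷_) (λ {cs'} {κ} r → ins-tail C c cs cs' κ (below-head h) r)
                  (insL-facts C B cs (below-tail h) v bs))

    insT-facts : ∀ r cs → Below N (node (just r) cs) →
      Pointwise (TreeInsertion N (node (just r) cs)) (insT N (node (just r) cs)) (kindsT (node (just r) cs))
    insT-facts r cs h@(d , c , (_ ∷ a)) =
      at-root ∷ pointwise-mapˡ (node (just r)) (λ {cs'} {κ} q → below-root cs' κ q)
        (insL-facts (extend rootCtx (just r) B) B cs (proj₂ d , proj₂ c , a)
          (extend-bounded (just r) (rootCtx-bounded B)) (β-children (just r) cs (proj₂ d)))
      where
      B = β (node (just r) cs)
      leaf = ins-labLeaf rootCtx r cs h (rootCtx-bounded B)
      at-root : TreeInsertion N (node (just r) cs) (node (just r) (cs ++ leafN N ∷ [])) rootLeaf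
      at-root = record
        { labelsE = SubtreeInsertion.labelsE leaf
        ; degE = LP.length-++ cs
        ; unlE = SubtreeInsertion.unlE leaf
        ; impE = SubtreeInsertion.impE leaf
        ; leadE = trans (lead-ctx (node (just r) (cs ++ leafN N ∷ [])))
                    (trans (SubtreeInsertion.leadE leaf) (cong (_+ 1) (sym (lead-ctx (node (just r) cs)))))
        ; degreeOK = SubtreeInsertion.degreeOK leaf
        ; canonicalOK = SubtreeInsertion.canonicalOK leaf
        ; removes = cong (node (just r)) (rm-snoc-leaf cs (proj₂ d , proj₂ c , a))
        ; sameRoot = refl }
      below-root : ∀ cs' κ → ForestInsertion N (extend rootCtx (just r) B) cs cs' κ →
        TreeInsertion N (node (just r) cs) (node (just r) cs') κ
      below-root cs' κ q = record
        { labelsE = SubtreeInsertion.labelsE s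
        ; degE = trans (trans (sym (LP.length-map β cs')) (trans (cong length (ForestInsertion.βs q)) (LP.length-map β cs)))
                   (trans (sym (NP.+-identityʳ _)) (cong (length cs +_) (sym (ForestInsertion.noRootChild q))))
        ; unlE = SubtreeInsertion.unlE s
        ; impE = SubtreeInsertion.impE s
        ; leadE = trans (lead-ctx (node (just r) cs'))
                    (trans (SubtreeInsertion.leadE s) (cong (_+ lead⁺ κ) (sym (lead-ctx (node (just r) cs)))))
        ; degreeOK = SubtreeInsertion.degreeOK s
        ; canonicalOK = SubtreeInsertion.canonicalOK s
        ; removes = cong (node (just r)) (ForestInsertion.removes q)
        ; sameRoot = refl }
        where
        s = ins-below rootCtx (just r) cs cs' κ h q

  -- Insertions at the top of a subtree differ from each other
  -- in the root label or in the number of children; an insertion deeper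
  -- down keeps the root label and the number of children, and removing N
  -- from it gives back the original children.
  children-injective : ∀ {ℓ ℓ' cs cs'} → node ℓ cs ≡ node ℓ' cs' → cs ≡ cs'
  children-injective refl = refl

  label-injective : ∀ {ℓ ℓ' cs cs'} → node ℓ cs ≡ node ℓ' cs' → ℓ ≡ ℓ'
  label-injective refl = refl

  just≢nothing : ∀ {l : ℕ} → just l ≢ nothing
  just≢nothing ()

  n≢n+1 : ∀ n → n ≢ n + 1
  n≢n+1 n e = NP.<-irrefl e (subst (n <_) (NP.+-comm 1 n) (NP.n<1+n n))

  two≢one : ∀ {cs : List Tree} → 2 ≤ length cs → length cs ≢ 1
  two≢one p e = NP.<-irrefl refl (subst (2 ≤_) e p)

  module Distinct (N : ℕ) where
    open InsertionFacts N

    below-forest-facts : ∀ cs → BelowL N cs → All (λ cs' → rmL N cs' ≡ cs × length cs' ≡ length cs) (insL N cs)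
    below-forest-facts cs h = pointwise-All facts (insL-facts rootCtx 0 cs h (rootCtx-bounded 0) (All.universal (λ _ → z≤n) cs))
      where
      facts : ∀ {cs' κ} → ForestInsertion N rootCtx cs cs' κ → rmL N cs' ≡ cs × length cs' ≡ length cs
      facts {cs'} r = ForestInsertion.removes r ,
        trans (sym (LP.length-map β cs')) (trans (cong length (ForestInsertion.βs r)) (LP.length-map β cs))

    below-member : ∀ ℓ cs {v} → v ∈ map (node ℓ) (insL N cs) → BelowL N cs →
      ∃ λ cs' → v ≡ node ℓ cs' × rmL N cs' ≡ cs × length cs' ≡ length cs
    below-member ℓ cs p h with MP.∈-map⁻ (node ℓ) p
    ... | cs' , m , e = cs' , e , All.lookup (below-forest-facts cs h) m

    new-label-inserted : ∀ S → Below N S → All (λ S' → N ∈ labels S') (insS N S)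
    new-label-inserted S h =
      pointwise-All (λ r → PermP.∈-resp-↭ (↭-sym (SubtreeInsertion.labelsE r)) (here refl)) (insS-facts rootCtx S h (rootCtx-bounded _))

    rm-unlParent : ∀ S → AllNodes DegreeCond S → AllLabels (_< N) S → rmL N (S ∷ leafN N ∷ []) ≡ S ∷ []
    rm-unlParent S d a rewrite rm-id N S d a | ≡ᵇ-refl N = refl

    here-below-disjoint : ∀ ℓ cs → Below N (node ℓ cs) → Disjoint (hereS N ℓ cs) (map (node ℓ) (insL N cs))
    here-below-disjoint ℓ cs h@(d , c , a) (p , q) with below-member ℓ cs q (below-children ℓ cs h)
    ... | cs' , refl , rm , len = distinct ℓ p rm len d a
      where
      grown : ∀ {ℓ ℓ'} → node ℓ cs' ≡ node ℓ' (cs ++ leafN N ∷ []) → length cs' ≡ length cs → ⊥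
      grown e len = n≢n+1 (length cs) (trans (sym len) (trans (cong length (children-injective e)) (LP.length-++ cs)))
      distinct : ∀ ℓ → node ℓ cs' ∈ hereS N ℓ cs → rmL N cs' ≡ cs → length cs' ≡ length cs →
        AllNodes DegreeCond (node ℓ cs) → AllLabels (_< N) (node ℓ cs) → ⊥
      distinct nothing (here e) rm len (d2 , ds) a =
        two≢one {cs} d2 (trans (cong length (sym rm))
          (trans (cong (λ z → length (rmL N z)) (children-injective e)) (cong length (rm-unlParent (node nothing cs) (d2 , ds) a))))
      distinct (just l) (here e) rm len d a = just≢nothing (label-injective e)
      distinct nothing (there (here e)) rm len d a = just≢nothing (sym (label-injective e))
      distinct (just l) (there (here e)) rm len d (l<N ∷ _) = NP.<-irrefl (MaybeP.just-injective (label-injective e)) l<N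
      distinct (just l) (there (there (here e))) rm len d a = grown e len
      distinct nothing (there (there (here e))) rm len d a = grown e len
      distinct nothing (there (there (there (here e)))) rm len d a = just≢nothing (sym (label-injective e))
      distinct (just l) (there (there (there ()))) rm len d a
      distinct nothing (there (there (there (there ())))) rm len d a

    here-unique : ∀ ℓ cs → Below N (node ℓ cs) → Unique (hereS N ℓ cs)
    here-unique (just l) cs (d , c , (l<N ∷ a)) =
        ((λ e → just≢nothing (sym (label-injective e))) ∷ (λ e → just≢nothing (sym (label-injective e))) ∷ [])
      ∷ ((λ e → NP.<-irrefl (sym (MaybeP.just-injective (label-injective e))) l<N) ∷ [])
      ∷ [] ∷ []
    here-unique nothing cs (d , c , a) =
        (  (λ e → just≢nothing (sym (label-injective e)))
         ∷ (λ e → two≢one {cs} (proj₁ d) (one-child (cong length (children-injective e))))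
         ∷ (λ e → just≢nothing (sym (label-injective e))) ∷ [])
      ∷ ((λ e → just≢nothing (label-injective e)) ∷ (λ e → two≢one {cs} (proj₁ d) (sym (cong length (children-injective e)))) ∷ [])
      ∷ ((λ e → just≢nothing (sym (label-injective e))) ∷ [])
      ∷ [] ∷ []
      where
      one-child : 2 ≡ length (cs ++ leafN N ∷ []) → length cs ≡ 1
      one-child e = NP.+-cancelʳ-≡ 1 (length cs) 1 (trans (sym (LP.length-++ cs)) (sym e))

    mutual
      insS-unique : ∀ S → Below N S → Unique (insS N S)
      insS-unique (node ℓ cs) h =
        UniqueP.++⁺ (here-unique ℓ cs h) (UniqueP.map⁺ children-injective (insL-unique cs (below-children ℓ cs h)))
          (here-below-disjoint ℓ cs h)

      -- Insertions into the first child contain N there, those into later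
      -- children keep the first child, which has no label N.
      insL-unique : ∀ cs → BelowL N cs → Unique (insL N cs)
      insL-unique [] h = []
      insL-unique (c ∷ cs) h =
        UniqueP.++⁺ (UniqueP.map⁺ LP.∷-injectiveˡ (insS-unique c (below-head h)))
          (UniqueP.map⁺ LP.∷-injectiveʳ (insL-unique cs (below-tail h))) head-tail-disjoint
        where
        head-tail-disjoint : Disjoint (map (_∷ cs) (insS N c)) (map (c ∷_) (insL N cs))
        head-tail-disjoint (p , q) with MP.∈-map⁻ (_∷ cs) p | MP.∈-map⁻ (c ∷_) q
        ... | c' , m , refl | cs' , m' , e =
          NP.<-irrefl refl (All.lookup (proj₂ (proj₂ (below-head h)))
            (subst (λ z → N ∈ labels z) (LP.∷-injectiveˡ e) (All.lookup (new-label-inserted c (below-head h)) m)))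

    insT-unique : ∀ r cs → Below N (node (just r) cs) → Unique (insT N (node (just r) cs))
    insT-unique r cs h = root-leaf-new ∷ UniqueP.map⁺ children-injective (insL-unique cs (below-children (just r) cs h))
      where
      root-leaf-new : All (node (just r) (cs ++ leafN N ∷ []) ≢_) (map (node (just r)) (insL N cs))
      root-leaf-new = All.tabulate λ m e → differ m e
        where
        differ : ∀ {v} → v ∈ map (node (just r)) (insL N cs) → node (just r) (cs ++ leafN N ∷ []) ≡ v → ⊥
        differ m e with below-member (just r) cs m (below-children (just r) cs h)
        ... | cs' , refl , _ , len =
          n≢n+1 (length cs) (trans (sym len) (trans (cong length (sym (children-injective e))) (LP.length-++ cs)))

  occurrences : ℕ → List ℕ → ℕ
  occurrences N xs = ℕSum.sum (map (λ x → if x ≡ᵇ N then 1 else 0) xs)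

  occurrences-++ : ∀ N xs ys → occurrences N (xs ++ ys) ≡ occurrences N xs + occurrences N ys
  occurrences-++ N xs ys = trans (cong ℕSum.sum (LP.map-++ _ xs ys)) (ℕSumP.sum-++ (map _ xs) (map _ ys))

  occurrences-↭ : ∀ N {xs ys} → xs ↭ ys → occurrences N xs ≡ occurrences N ys
  occurrences-↭ N p = ℕSumP.sum-↭ (PermP.map⁺ _ p)

  occurrences-zero : ∀ N xs → occurrences N xs ≡ 0 → All (_≤ N) xs → All (_< N) xs
  occurrences-zero N [] _ _ = []
  occurrences-zero N (x ∷ xs) e (x≤ ∷ a) with x ≡ᵇ N in eq
  ... | false = NP.≤∧≢⇒< x≤ (λ { refl → contradiction (trans (sym (≡ᵇ-refl N)) eq) }) ∷ occurrences-zero N xs e a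
    where
    contradiction : true ≢ false
    contradiction ()

  occurrences-below : ∀ N xs → All (_< N) xs → occurrences N xs ≡ 0
  occurrences-below N [] _ = refl
  occurrences-below N (x ∷ xs) (x< ∷ a) rewrite ≡ᵇ-false x< = occurrences-below N xs a

  AtMost : ℕ → Tree → Set
  AtMost N S = AllNodes DegreeCond S × AllNodes Canonical S × AllLabels (_≤ N) S

  AtMostL : ℕ → List Tree → Set
  AtMostL N cs = AllNodesL DegreeCond cs × AllNodesL Canonical cs × All (_≤ N) (labelsL cs)

  sum≡1 : ∀ a b → a + b ≡ 1 → (a ≡ 1 × b ≡ 0) ⊎ (a ≡ 0 × b ≡ 1)
  sum≡1 zero b e = inj₂ (refl , e)
  sum≡1 (suc zero) zero e = inj₁ (refl , refl)
  sum≡1 (suc zero) (suc b) ()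
  sum≡1 (suc (suc a)) b ()

  module Completeness (N : ℕ) where
    open InsertionFacts N

    SubtreeOrigin : Tree → Set
    SubtreeOrigin S' = (S' ≡ leafN N) ⊎ (∃ λ S → Below N S × S' ∈ insS N S × labels S' ↭ N ∷ labels S)

    ForestOrigin : List Tree → Set
    ForestOrigin cs' = (∃ λ cs₀ → cs' ≡ cs₀ ++ leafN N ∷ [] × BelowL N cs₀ × Increasing (map β cs₀))
                     ⊎ (∃ λ cs → BelowL N cs × cs' ∈ insL N cs × map β cs' ≡ map β cs × labelsL cs' ↭ N ∷ labelsL cs)

    unlParent∈ : ∀ S → node nothing (S ∷ leafN N ∷ []) ∈ insS N S
    unlParent∈ (node ℓ cs) = here refl

    labParent∈ : ∀ S → node (just N) (S ∷ []) ∈ insS N S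
    labParent∈ (node ℓ cs) = there (here refl)

    origin-labelledN : ∀ cs' → AllNodesL DegreeCond cs' → AllNodesL Canonical cs' → All (_< N) (labelsL cs') →
      Increasing (map β cs') → SubtreeOrigin (node (just N) cs')
    origin-labelledN [] _ _ _ _ = inj₁ refl
    origin-labelledN (c ∷ []) (d , _) (cn , _) a _ =
      inj₂ (c , (d , cn , AllP.++⁻ˡ (labels c) a) , labParent∈ c , prep N (↭-reflexive (LP.++-identityʳ _)))
    origin-labelledN (c₁ ∷ c₂ ∷ r) d cn a inc =
      inj₂ (node nothing (c₁ ∷ c₂ ∷ r) , ((s≤s (s≤s z≤n) , d) , (inc , cn) , a) , there (there (there (here refl))) , ↭-refl)

    origin-labelled : ∀ k cs' → k < N → Increasing (map β cs') → ForestOrigin cs' → SubtreeOrigin (node (just k) cs')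
    origin-labelled k cs' k<N inc (inj₁ (cs₀ , refl , h₀ , inc₀)) =
      inj₂ (node (just k) cs₀ , ((tt , proj₁ h₀) , (inc₀ , proj₁ (proj₂ h₀)) , (k<N ∷ proj₂ (proj₂ h₀))) ,
            there (there (here refl)) , ↭-trans (prep k (labelsL-snoc cs₀)) (swap k N ↭-refl))
    origin-labelled k cs' k<N inc (inj₂ (cs , h , mem , βs , labels↭)) =
      inj₂ (node (just k) cs , ((tt , proj₁ h) , (subst Increasing βs inc , proj₁ (proj₂ h)) , (k<N ∷ proj₂ (proj₂ h))) ,
            MP.∈-++⁺ʳ (hereS N (just k) cs) (MP.∈-map⁺ (node (just k)) mem) , ↭-trans (prep k labels↭) (swap k N ↭-refl))

    origin-unlabelled : ∀ cs' → 2 ≤ length cs' → Increasing (map β cs') → ForestOrigin cs' → SubtreeOrigin (node nothing cs')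
    origin-unlabelled _ (s≤s ()) _ (inj₁ ([] , refl , _))
    origin-unlabelled _ _ _ (inj₁ (c ∷ [] , refl , (d , cn , a) , _)) =
      inj₂ (c , (proj₁ d , proj₁ cn , AllP.++⁻ˡ (labels c) a) , unlParent∈ c , snoc↭ N (labels c))
    origin-unlabelled _ _ _ (inj₁ (c₁ ∷ c₂ ∷ r , refl , (d , cn , a) , inc₀)) =
      inj₂ (node nothing (c₁ ∷ c₂ ∷ r) , ((s≤s (s≤s z≤n) , d) , (inc₀ , cn) , a) , there (there (here refl)) ,
            labelsL-snoc (c₁ ∷ c₂ ∷ r))
    origin-unlabelled cs' two inc (inj₂ (cs , h , mem , βs , labels↭)) =
      inj₂ (node nothing cs , ((subst (2 ≤_) length≡ two , proj₁ h) , (subst Increasing βs inc , proj₁ (proj₂ h)) , proj₂ (proj₂ h)) ,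
            MP.∈-++⁺ʳ (hereS N nothing cs) (MP.∈-map⁺ (node nothing) mem) , labels↭)
      where
      length≡ : length cs' ≡ length cs
      length≡ = trans (sym (LP.length-map β cs')) (trans (cong length βs) (LP.length-map β cs))

    -- If that tree is the leaf N,
    -- canonicity forces it to be the last child (later siblings would have
    -- β > N), so the forest is a leaf appended to the empty forest.
    origin-head : ∀ c' rest → AtMostL N rest → Increasing (β c' ∷ map β rest) → All (_< N) (labelsL rest) →
      SubtreeOrigin c' → ForestOrigin (c' ∷ rest)
    origin-head c' rest (d , cn , a) inc a< (inj₁ refl) =
      inj₁ ([] , cong (leafN N ∷_) (no-later-sibling rest inc d a) , (tt , tt , []) , tt)
      where
      no-later-sibling : ∀ rest → Increasing (N ∷ map β rest) → AllNodesL DegreeCond rest → All (_≤ N) (labelsL rest) → rest ≡ []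
      no-later-sibling [] _ _ _ = refl
      no-later-sibling (r ∷ rs) (N<β , _) (dr , _) ar =
        ⊥-elim (NP.<-irrefl refl (NP.<-≤-trans N<β (All.lookup (AllP.++⁻ˡ (labels r) ar) (minL-∈ (labels r) (labels-nonEmpty r dr)))))
    origin-head c' rest (d , cn , a) inc a< (inj₂ (c₀ , (d₀ , cn₀ , a₀) , mem , labels↭)) =
      inj₂ (c₀ ∷ rest , ((d₀ , d) , (cn₀ , cn) , AllP.++⁺ a₀ a<) ,
            MP.∈-++⁺ˡ (MP.∈-map⁺ (_∷ rest) mem) , cong (_∷ map β rest) β≡ , PermP.++⁺ʳ (labelsL rest) labels↭)
      where
      β≡ : β c' ≡ β c₀
      β≡ = minL-insert-larger (labels c₀) (labels c') labels↭ (labels-nonEmpty c₀ d₀) a₀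

    origin-tail : ∀ c' rest → AtMost N c' → All (_< N) (labels c') → Increasing (β c' ∷ map β rest) →
      ForestOrigin rest → ForestOrigin (c' ∷ rest)
    origin-tail c' rest (d , cn , _) a< inc (inj₁ (cs₀ , refl , (d₀ , cn₀ , a₀) , _)) =
      inj₁ (c' ∷ cs₀ , refl , ((d , d₀) , (cn , cn₀) , AllP.++⁺ a< a₀) ,
            inc-prefix (map β (c' ∷ cs₀)) (map β (leafN N ∷ [])) (subst Increasing (LP.map-++ β (c' ∷ cs₀) (leafN N ∷ [])) inc))
    origin-tail c' rest (d , cn , _) a< inc (inj₂ (cs , (d₀ , cn₀ , a₀) , mem , βs , labels↭)) =
      inj₂ (c' ∷ cs , ((d , d₀) , (cn , cn₀) , AllP.++⁺ a< a₀) ,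
            MP.∈-++⁺ʳ (map (_∷ cs) (insS N c')) (MP.∈-map⁺ (c' ∷_) mem) , cong (β c' ∷_) βs ,
            ↭-trans (PermP.++⁺ˡ (labels c') labels↭) (PermP.shift N (labels c') (labelsL cs)))

    mutual
      subtree-origin : ∀ S' → AtMost N S' → occurrences N (labels S') ≡ 1 → SubtreeOrigin S'
      subtree-origin (node (just k) cs') (d , c , (k≤ ∷ a)) o with k ℕ.≟ N
      ... | yes refl = origin-labelledN cs' (proj₂ d) (proj₂ c) (occurrences-zero N (labelsL cs') none a) (proj₁ c)
        where
        none : occurrences N (labelsL cs') ≡ 0
        none = NP.suc-injective (trans (cong (λ b → (if b then 1 else 0) + occurrences N (labelsL cs')) (sym (≡ᵇ-refl N))) o)
      ... | no k≢N = origin-labelled k cs' k<N (proj₁ c) (forest-origin cs' (proj₂ d , proj₂ c , a) (proj₁ c) once)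
        where
        k<N : k < N
        k<N = NP.≤∧≢⇒< k≤ k≢N
        once : occurrences N (labelsL cs') ≡ 1
        once = trans (cong (λ b → (if b then 1 else 0) + occurrences N (labelsL cs')) (sym (≡ᵇ-false k<N))) o
      subtree-origin (node nothing cs') (d , c , a) o =
        origin-unlabelled cs' (proj₁ d) (proj₁ c) (forest-origin cs' (proj₂ d , proj₂ c , a) (proj₁ c) o)

      forest-origin : ∀ cs' → AtMostL N cs' → Increasing (map β cs') → occurrences N (labelsL cs') ≡ 1 → ForestOrigin cs'
      forest-origin [] _ _ ()
      forest-origin (c' ∷ rest) (d , c , a) inc o
        with sum≡1 (occurrences N (labels c')) (occurrences N (labelsL rest)) (trans (sym (occurrences-++ N (labels c') (labelsL rest))) o)
      ... | inj₁ (once , none) =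
        origin-head c' rest rest-ok inc (occurrences-zero N (labelsL rest) none (proj₂ (proj₂ rest-ok)))
          (subtree-origin c' (proj₁ d , proj₁ c , AllP.++⁻ˡ (labels c') a) once)
        where
        rest-ok = proj₂ d , proj₂ c , AllP.++⁻ʳ (labels c') a
      ... | inj₂ (none , once) =
        origin-tail c' rest (proj₁ d , proj₁ c , AllP.++⁻ˡ (labels c') a)
          (occurrences-zero N (labels c') none (AllP.++⁻ˡ (labels c') a)) inc
          (forest-origin rest (proj₂ d , proj₂ c , AllP.++⁻ʳ (labels c') a) (inc-tail (map β rest) inc) once)

  gregTrees : ℕ → List Tree
  gregTrees zero = []
  gregTrees (suc zero) = node (just 1) [] ∷ []
  gregTrees (suc (suc k)) = concatMap (insT (suc (suc k))) (gregTrees (suc k))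

  labels-bound : ∀ m → All (_< suc m) (map suc (upTo m))
  labels-bound m = AllP.map⁺ (All.map s≤s (upTo-bound m))
    where
    upTo-bound : ∀ m → All (_< m) (upTo m)
    upTo-bound zero = []
    upTo-bound (suc m) = subst (All (_< suc m)) (LP.applyUpTo-∷ʳ (λ x → x) m)
      (AllP.++⁺ (All.map NP.m<n⇒m<1+n (upTo-bound m)) (NP.n<1+n m ∷ []))

  labels-snoc : ∀ m → map suc (upTo (suc m)) ↭ suc m ∷ map suc (upTo m)
  labels-snoc m = ↭-trans (↭-reflexive (cong (map suc) (sym (LP.applyUpTo-∷ʳ (λ x → x) m))))
                    (↭-trans (↭-reflexive (LP.map-++ suc (upTo m) (m ∷ []))) (snoc↭ (suc m) (map suc (upTo m))))

  greg1-unique : ∀ T → GregTree 1 T → T ≡ node (just 1) []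
  greg1-unique (node ℓ cs) g with GregTree.rootIs1 g
  ... | refl = cong (node (just 1)) (no-children cs (PermP.↭-empty-inv (PermP.drop-∷ (GregTree.labelling g))) (proj₂ (GregTree.degree g)))
    where
    no-children : ∀ cs → labelsL cs ≡ [] → AllNodesL DegreeCond cs → cs ≡ []
    no-children [] _ _ = refl
    no-children (c ∷ cs) e (dc , _) with labels c | labels-nonEmpty c dc
    no-children (c ∷ cs) () (dc , _) | _ ∷ _ | _

  greg1 : GregTree 1 (node (just 1) [])
  greg1 = record { rootIs1 = refl ; labelling = ↭-refl ; degree = tt , tt ; canonical = tt , tt }

  rootShape : ∀ {m} T → GregTree m T → ∃ λ cs → T ≡ node (just 1) cs
  rootShape (node ℓ cs) g with GregTree.rootIs1 g
  ... | refl = cs , refl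

  module Growth (k : ℕ) where
    N = suc (suc k)
    open InsertionFacts N
    open Distinct N
    open Completeness N

    greg-below : ∀ cs → GregTree (suc k) (node (just 1) cs) → Below N (node (just 1) cs)
    greg-below cs g = GregTree.degree g , GregTree.canonical g ,
      PermP.All-resp-↭ (↭-sym (GregTree.labelling g)) (labels-bound (suc k))

    insertion-of : ∀ cs → GregTree (suc k) (node (just 1) cs) → ∀ {T'} → T' ∈ insT N (node (just 1) cs) →
      ∃ λ κ → TreeInsertion N (node (just 1) cs) T' κ
    insertion-of cs g m = pointwise-lookup (insT-facts 1 cs (greg-below cs g)) m

    sound : ∀ T → GregTree (suc k) T → ∀ {T'} → T' ∈ insT N T → GregTree N T'
    sound T g m with rootShape T g
    ... | cs , refl with insertion-of cs g m
    ...   | κ , r = record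
      { rootIs1 = TreeInsertion.sameRoot r
      ; labelling = ↭-trans (TreeInsertion.labelsE r) (↭-trans (prep N (GregTree.labelling g)) (↭-sym (labels-snoc (suc k))))
      ; degree = TreeInsertion.degreeOK r
      ; canonical = TreeInsertion.canonicalOK r }

    rm-insT : ∀ T → GregTree (suc k) T → ∀ {T'} → T' ∈ insT N T → rmT N T' ≡ T
    rm-insT T g m with rootShape T g
    ... | cs , refl = TreeInsertion.removes (proj₂ (insertion-of cs g m))

    insT-unique-greg : ∀ T → GregTree (suc k) T → Unique (insT N T)
    insT-unique-greg T g with rootShape T g
    ... | cs , refl = insT-unique 1 cs (greg-below cs g)

    -- Different trees have disjoint sets of insertions, as removal recovers the tree.
    insertions-disjoint : ∀ L → Unique L → All (GregTree (suc k)) L → AllPairs (λ T₁ T₂ → Disjoint (insT N T₁) (insT N T₂)) L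
    insertions-disjoint [] _ _ = []
    insertions-disjoint (T ∷ L) (T∉ ∷ u) (g ∷ gs) = from-T L T∉ gs ∷ insertions-disjoint L u gs
      where
      from-T : ∀ L → All (T ≢_) L → All (GregTree (suc k)) L → All (λ T₂ → Disjoint (insT N T) (insT N T₂)) L
      from-T [] _ _ = []
      from-T (T₂ ∷ L) (T≢T₂ ∷ ns) (g₂ ∷ gs) =
        (λ (p , q) → T≢T₂ (trans (sym (rm-insT T g p)) (rm-insT T₂ g₂ q))) ∷ from-T L ns gs

    labels-grown : ∀ cs' → GregTree N (node (just 1) cs') → labels (node (just 1) cs') ↭ N ∷ map suc (upTo (suc k))
    labels-grown cs' g = ↭-trans (GregTree.labelling g) (labels-snoc (suc k))

    origin-tree : ∀ cs' → GregTree N (node (just 1) cs') → ForestOrigin cs' →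
      ∃ λ T → GregTree (suc k) T × node (just 1) cs' ∈ insT N T
    origin-tree cs' g (inj₁ (cs₀ , refl , h₀ , inc₀)) = node (just 1) cs₀ , record
        { rootIs1 = refl
        ; labelling = PermP.drop-∷ (↭-trans (↭-sym (↭-trans (prep 1 (labelsL-snoc cs₀)) (swap 1 N ↭-refl))) (labels-grown _ g))
        ; degree = tt , proj₁ h₀
        ; canonical = inc₀ , proj₁ (proj₂ h₀) } , here refl
    origin-tree cs' g (inj₂ (cs , h , mem , βs , labels↭)) = node (just 1) cs , record
        { rootIs1 = refl
        ; labelling = PermP.drop-∷ (↭-trans (↭-sym (↭-trans (prep 1 labels↭) (swap 1 N ↭-refl))) (labels-grown _ g))
        ; degree = tt , proj₁ h
        ; canonical = subst Increasing βs (proj₁ (GregTree.canonical g)) , proj₁ (proj₂ h) } , there (MP.∈-map⁺ (node (just 1)) mem)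

    complete : ∀ T' → GregTree N T' → ∃ λ T → GregTree (suc k) T × T' ∈ insT N T
    complete T' g with rootShape T' g
    ... | cs' , refl = origin-tree cs' g
          (forest-origin cs' (proj₂ (GregTree.degree g) , proj₂ (GregTree.canonical g) , All-labels-children (just 1) cs' labels≤)
            (proj₁ (GregTree.canonical g)) once)
      where
      labels≤ : All (_≤ N) (labels (node (just 1) cs'))
      labels≤ = PermP.All-resp-↭ (↭-sym (labels-grown cs' g)) (NP.≤-refl ∷ All.map NP.<⇒≤ (labels-bound (suc k)))
      once : occurrences N (labelsL cs') ≡ 1
      once = trans (occurrences-↭ N (labels-grown cs' g))
        (trans (cong (λ b → (if b then 1 else 0) + occurrences N (map suc (upTo (suc k)))) (≡ᵇ-refl N))
          (cong suc (occurrences-below N _ (labels-bound (suc k)))))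

  gregTrees-enumerate : ∀ m → Enumerates (suc m) (gregTrees (suc m))
  gregTrees-enumerate zero = ([] ∷ []) , λ T → mk⇔ (λ { (here refl) → greg1 }) (λ g → here (greg1-unique T g))
  gregTrees-enumerate (suc k) = unique , λ T' → mk⇔ to from
    where
    open Growth k
    L = gregTrees (suc k)
    IH = gregTrees-enumerate k
    member : ∀ T → T ∈ L → GregTree (suc k) T
    member T = Equivalence.to (proj₂ IH T)
    to : ∀ {T'} → T' ∈ concatMap (insT N) L → GregTree N T'
    to p with MP.∈-concat⁻′ (map (insT N) L) p
    ... | xs , p₁ , p₂ with MP.∈-map⁻ (insT N) p₂
    ...   | T , T∈ , refl = sound T (member T T∈) p₁
    from : ∀ {T'} → GregTree N T' → T' ∈ concatMap (insT N) L
    from {T'} g with complete T' g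
    ... | T , gT , m = MP.∈-concat⁺′ m (MP.∈-map⁺ (insT N) (Equivalence.from (proj₂ IH T) gT))
    all-greg : All (GregTree (suc k)) L
    all-greg = All.tabulate (λ {T} T∈ → member T T∈)
    unique : Unique (concatMap (insT N) L)
    unique = UniqueP.concat⁺ (AllP.map⁺ (All.map (λ {T} g → insT-unique-greg T g) all-greg))
                             (AllPairsP.map⁺ (insertions-disjoint L (proj₁ IH) all-greg))

  -- Along the generation the root has a child and lead T > degRoot T (true
  -- for the tree 1–2 and preserved by insertions, as deg⁺ ≤ lead⁺); these
  -- bounds make the truncated exponents of the weight additive.
  RootBounds : Tree → Set
  RootBounds T = 1 ≤ degRoot T × suc (degRoot T) ≤ lead T

  gregTrees-step : ∀ k {T'} → T' ∈ gregTrees (suc (suc (suc k))) →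
    ∃ λ T → T ∈ gregTrees (suc (suc k)) × T' ∈ insT (suc (suc (suc k))) T
  gregTrees-step k p with MP.∈-concat⁻′ (map (insT (suc (suc (suc k)))) (gregTrees (suc (suc k)))) p
  ... | xs , p₁ , p₂ with MP.∈-map⁻ (insT (suc (suc (suc k)))) p₂
  ...   | T , T∈ , refl = T , T∈ , p₁

  gregTrees-greg : ∀ k {T} → T ∈ gregTrees (suc k) → GregTree (suc k) T
  gregTrees-greg k {T} = Equivalence.to (proj₂ (gregTrees-enumerate k) T)

  gregTrees-rootBounds : ∀ k {T} → T ∈ gregTrees (suc (suc k)) → RootBounds T
  gregTrees-rootBounds zero (here refl) = s≤s z≤n , s≤s (s≤s z≤n)
  gregTrees-rootBounds (suc k) p with gregTrees-step k p
  ... | T , T∈ , m with rootShape T (gregTrees-greg (suc k) T∈)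
  ...   | cs , refl with Growth.insertion-of (suc k) cs (gregTrees-greg (suc k) T∈) m
  ...     | κ , r with gregTrees-rootBounds k T∈
  ...       | deg≥1 , lead>deg =
    subst (1 ≤_) (sym (TreeInsertion.degE r)) (NP.≤-trans deg≥1 (NP.m≤m+n _ _)) ,
    subst₂ (λ a b → suc a ≤ b) (sym (TreeInsertion.degE r)) (sym (TreeInsertion.leadE r)) (NP.+-mono-≤ lead>deg (Δdeg≤Δlead κ))


module ExponentArithmetic where

  open import Data.Nat using (zero; suc; _+_; _∸_; _≤_; s≤s)
  import Data.Nat.Properties as NP
  open import Relation.Binary.PropositionalEquality

  ∸1-shift : ∀ {a} d → 1 ≤ a → a + d ∸ 1 ≡ d + (a ∸ 1)
  ∸1-shift {suc a} d _ = NP.+-comm a d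

  cancel-shift : ∀ {a b m n} → a + n ≡ b + m → a ≡ m + b ∸ n
  cancel-shift {a} {b} {m} {n} e =
    trans (sym (NP.m+n∸n≡m a n)) (trans (cong (_∸ n) e) (cong (_∸ n) (NP.+-comm b m)))

  ∸-gap : ∀ {a b c d} → suc b ≤ a → d ≤ c → a + c ∸ (b + d) ∸ 1 ≡ c ∸ d + (a ∸ b ∸ 1)
  ∸-gap {suc a} {zero} {c} {d} _ d≤c = trans (cong (_∸ 1) (NP.+-∸-assoc (suc a) d≤c)) (NP.+-comm a (c ∸ d))
  ∸-gap {suc a} {suc b} (s≤s b<a) d≤c = ∸-gap b<a d≤c


module Recurrence where

  open import Defs
  open Derivatives
  open GregTrees
  open ExponentArithmetic
  open import Data.Nat as ℕ using (ℕ; zero; suc; _∸_)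
  import Data.Nat.Properties as NP
  open import Data.Integer using (ℤ; +_; _+_; _*_; _-_; _^_; 1ℤ; 0ℤ)
  open import Data.Maybe using (just; nothing)
  open import Data.List using (List; []; _∷_; map; length; upTo; concatMap)
  import Data.List.Properties as LP
  open import Data.List.Relation.Binary.Permutation.Propositional.Properties using (↭-length)
  open import Data.Product using (_,_)
  open import Relation.Binary.PropositionalEquality
  open import Data.List.Membership.Propositional using (_∈_)
  import Data.List.Relation.Unary.All as All
  open import Data.List.Relation.Binary.Pointwise using (Pointwise; []; _∷_)
  open import Data.Integer.Tactic.RingSolver using (solve-∀)

  sum-pointwise : ∀ {A B : Set} (f : A → ℤ) (g : B → ℤ) {R : A → B → Set} {xs ys} →
    (∀ {a b} → R a b → f a ≡ g b) → Pointwise R xs ys → sumℤ (map f xs) ≡ sumℤ (map g ys)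
  sum-pointwise f g h [] = refl
  sum-pointwise f g h (r ∷ rs) = cong₂ _+_ (h r) (sum-pointwise f g h rs)

  sum-concatMap : ∀ {A B : Set} (f : B → ℤ) (g : A → List B) xs →
    sumℤ (map f (concatMap g xs)) ≡ sumℤ (map (λ a → sumℤ (map f (g a))) xs)
  sum-concatMap f g [] = refl
  sum-concatMap f g (a ∷ xs) =
    trans (cong sumℤ (LP.map-++ f (g a) (concatMap g xs)))
      (trans (sum-++ (map f (g a)) (map f (concatMap g xs)))
        (cong (λ q → sumℤ (map f (g a)) + q) (sum-concatMap f g xs)))

  stepDeriv-sum : ∀ {A : Set} n j x y z t (prev cur next : A → ℤ) xs →
    sumℤ (map (λ a → stepDeriv n j x y z t (prev a) (cur a) (next a)) xs)
      ≡ stepDeriv n j x y z t (sumℤ (map prev xs)) (sumℤ (map cur xs)) (sumℤ (map next xs))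
  stepDeriv-sum n j x y z t prev cur next [] = vanish x y z t (+ n) (+ j) (+ (j ∸ 1))
    where
    vanish : ∀ x y z t N J J' → 0ℤ ≡
      (x + N * z + N * (y + t) + J * (y + y + t + 1ℤ)) * 0ℤ + (N * J + J * J') * 0ℤ + (y + t) * (y + 1ℤ) * 0ℤ
    vanish = solve-∀
  stepDeriv-sum n j x y z t prev cur next (a ∷ xs)
    rewrite stepDeriv-sum n j x y z t prev cur next xs =
      additive x y z t (+ n) (+ j) (+ (j ∸ 1)) (prev a) (cur a) (next a)
        (sumℤ (map prev xs)) (sumℤ (map cur xs)) (sumℤ (map next xs))
    where
    additive : ∀ x y z t N J J' A B C A' B' C' →
      (x + N * z + N * (y + t) + J * (y + y + t + 1ℤ)) * B + (N * J + J * J') * A + (y + t) * (y + 1ℤ) * C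
      + ((x + N * z + N * (y + t) + J * (y + y + t + 1ℤ)) * B' + (N * J + J * J') * A' + (y + t) * (y + 1ℤ) * C')
      ≡ (x + N * z + N * (y + t) + J * (y + y + t + 1ℤ)) * (B + B') + (N * J + J * J') * (A + A')
        + (y + t) * (y + 1ℤ) * (C + C')
    additive = solve-∀

  -- Summing a function g of the kinds of all insertions into a subtree: with
  -- L labelled and U unlabelled vertices there are L insertions labLeaf,
  -- L + U each of unlParent and labParent, and U each of unlLeaf and relabel.
  module KindCount (g : Kind → ℤ) where
    form : ℕ → ℕ → ℤ
    form L U = + L * g labLeaf + (+ L + + U) * (g unlParent + g labParent) + + U * (g unlLeaf + g relabel)

    mutual
      kinds-sumS : ∀ S → sumℤ (map g (kindsS S)) ≡ form (length (labels S)) (unl S)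
      kinds-sumS (node (just l) cs) =
        trans (cong (λ q → g unlParent + (g labParent + (g labLeaf + q))) (kinds-sumL cs))
          (labelled (+ length (labelsL cs)) (+ unlL cs) (g labLeaf) (g unlParent) (g labParent) (g unlLeaf) (g relabel))
        where
        labelled : ∀ L U a b c d e → b + (c + (a + (L * a + (L + U) * (b + c) + U * (d + e))))
          ≡ (1ℤ + L) * a + ((1ℤ + L) + U) * (b + c) + U * (d + e)
        labelled = solve-∀
      kinds-sumS (node nothing cs) =
        trans (cong (λ q → g unlParent + (g labParent + (g unlLeaf + (g relabel + q)))) (kinds-sumL cs))
          (unlabelled (+ length (labelsL cs)) (+ unlL cs) (g labLeaf) (g unlParent) (g labParent) (g unlLeaf) (g relabel))
        where
        unlabelled : ∀ L U a b c d e → b + (c + (d + (e + (L * a + (L + U) * (b + c) + U * (d + e)))))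
          ≡ L * a + (L + (1ℤ + U)) * (b + c) + (1ℤ + U) * (d + e)
        unlabelled = solve-∀

      kinds-sumL : ∀ cs → sumℤ (map g (kindsL cs)) ≡ form (length (labelsL cs)) (unlL cs)
      kinds-sumL [] = vanish (g labLeaf) (g unlParent) (g labParent) (g unlLeaf) (g relabel)
        where
        vanish : ∀ a b c d e → 0ℤ ≡ 0ℤ * a + (0ℤ + 0ℤ) * (b + c) + 0ℤ * (d + e)
        vanish = solve-∀
      kinds-sumL (c ∷ cs) =
        trans (cong sumℤ (LP.map-++ g (kindsS c) (kindsL cs)))
          (trans (sum-++ (map g (kindsS c)) (map g (kindsL cs)))
            (trans (cong₂ _+_ (kinds-sumS c) (kinds-sumL cs))
              (trans (additive (+ length (labels c)) (+ unl c) (+ length (labelsL cs)) (+ unlL cs)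
                        (g labLeaf) (g unlParent) (g labParent) (g unlLeaf) (g relabel))
                (cong (λ q → form q (unl c ℕ.+ unlL cs)) (sym (LP.length-++ (labels c)))))))
        where
        additive : ∀ L U L' U' a b c d e →
          (L * a + (L + U) * (b + c) + U * (d + e)) + (L' * a + (L' + U') * (b + c) + U' * (d + e))
          ≡ (L + L') * a + ((L + L') + (U + U')) * (b + c) + (U + U') * (d + e)
        additive = solve-∀

  module TreeSums (x y z t : ℤ) where
    open Monomials x y z t

    ∂weight : ℕ → Tree → ℤ
    ∂weight j T = μ j (degRoot T ∸ 1) (unl T) (lead T ∸ degRoot T ∸ 1) (impp T)

    ∂weight-zero : ∀ T → ∂weight 0 T ≡ weight x y z t T
    ∂weight-zero T = trans (cong (λ q → x ^ (degRoot T ∸ 1) * q * z ^ (lead T ∸ degRoot T ∸ 1) * t ^ impp T)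
                                  (∂pow-zero y (unl T)))
                           (reorder (x ^ (degRoot T ∸ 1)) (y ^ unl T) (z ^ (lead T ∸ degRoot T ∸ 1)) (t ^ impp T))
      where
      reorder : ∀ X Y Z T → X * Y * Z * T ≡ Y * T * X * Z
      reorder = solve-∀

    kindMonomial : ℕ → Tree → Kind → ℤ
    kindMonomial j T κ =
      μ j (deg⁺ κ ℕ.+ (degRoot T ∸ 1)) (unl⁺ κ ℕ.+ unl T ∸ unl⁻ κ)
          ((lead⁺ κ ∸ deg⁺ κ) ℕ.+ (lead T ∸ degRoot T ∸ 1)) (impp⁺ κ ℕ.+ impp T)

    μ-cong : ∀ j {a a' b b' c c' d d'} → a ≡ a' → b ≡ b' → c ≡ c' → d ≡ d' → μ j a b c d ≡ μ j a' b' c' d'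
    μ-cong j refl refl refl refl = refl

    insertion-monomial : ∀ {N} j {T T' κ} → RootBounds T → TreeInsertion N T T' κ → ∂weight j T' ≡ kindMonomial j T κ
    insertion-monomial j {T} {T'} {κ} (deg≥1 , lead>deg) r = μ-cong j
      (trans (cong (_∸ 1) (TreeInsertion.degE r)) (∸1-shift (deg⁺ κ) deg≥1))
      (cancel-shift {unl T'} {unl T} {unl⁺ κ} {unl⁻ κ} (TreeInsertion.unlE r))
      (trans (cong₂ (λ l d → l ∸ d ∸ 1) (TreeInsertion.leadE r) (TreeInsertion.degE r)) (∸-gap lead>deg (Δdeg≤Δlead κ)))
      (trans (TreeInsertion.impE r) (NP.+-comm (impp T) (impp⁺ κ)))

    children-∂weight : ∀ k j {T} → T ∈ gregTrees (suc (suc k)) →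
      sumℤ (map (∂weight j) (insT (suc (suc (suc k))) T))
        ≡ stepDeriv (suc k) j x y z t (∂weight (j ∸ 1) T) (∂weight j T) (∂weight (suc j) T)
    children-∂weight k j {T} Tin with rootShape T (gregTrees-greg (suc k) Tin)
    ... | cs , refl = begin
      sumℤ (map (∂weight j) (insT (suc (suc (suc k))) T))
        ≡⟨ sum-pointwise (∂weight j) g (insertion-monomial j (gregTrees-rootBounds k Tin))
             (InsertionFacts.insT-facts (suc (suc (suc k))) 1 cs (Growth.greg-below (suc k) cs greg)) ⟩
      g rootLeaf + sumℤ (map g (kindsL cs))
        ≡⟨ cong (λ q → g rootLeaf + q) (KindCount.kinds-sumL g cs) ⟩
      g rootLeaf + KindCount.form g (length (labelsL cs)) (unlL cs)
        ≡⟨ cong (λ L → g rootLeaf + KindCount.form g L (unlL cs)) labelCount ⟩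
      g rootLeaf + KindCount.form g (suc k) (unlL cs)
        ≡⟨ monomial-step (suc k) j (degRoot T ∸ 1) (unl T) (lead T ∸ degRoot T ∸ 1) (impp T) ⟩
      stepDeriv (suc k) j x y z t (∂weight (j ∸ 1) T) (∂weight j T) (∂weight (suc j) T) ∎
      where
      open ≡-Reasoning
      g = kindMonomial j T
      greg = gregTrees-greg (suc k) Tin
      labelCount : length (labelsL cs) ≡ suc k
      labelCount = NP.suc-injective (trans (↭-length (GregTree.labelling greg))
        (trans (LP.length-map suc (upTo (suc (suc k)))) (LP.length-applyUpTo (λ i → i) (suc (suc k)))))

    ∂Q-trees : ∀ k j → ∂eval x (y + 1ℤ) z (t - 1ℤ) j (Q (suc k)) ≡ sumℤ (map (∂weight j) (gregTrees (suc (suc k))))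
    ∂Q-trees zero zero = refl
    ∂Q-trees zero (suc j) = refl
    ∂Q-trees (suc k) j = begin
      ∂eval x (y + 1ℤ) z (t - 1ℤ) j (Q (suc (suc k)))
        ≡⟨ ShiftedStep.D-step x y z t (suc k) j (Q (suc k)) ⟩
      stepDeriv (suc k) j x y z t (∂Q (j ∸ 1)) (∂Q j) (∂Q (suc j))
        ≡⟨ cong₃ (stepDeriv (suc k) j x y z t) (∂Q-trees k (j ∸ 1)) (∂Q-trees k j) (∂Q-trees k (suc j)) ⟩
      stepDeriv (suc k) j x y z t (sumℤ (map (∂weight (j ∸ 1)) G)) (sumℤ (map (∂weight j) G)) (sumℤ (map (∂weight (suc j)) G))
        ≡⟨ stepDeriv-sum (suc k) j x y z t (∂weight (j ∸ 1)) (∂weight j) (∂weight (suc j)) G ⟨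
      sumℤ (map (λ T → stepDeriv (suc k) j x y z t (∂weight (j ∸ 1) T) (∂weight j T) (∂weight (suc j) T)) G)
        ≡⟨ cong sumℤ (LP.map-cong-local (All.tabulate (λ T∈ → sym (children-∂weight k j T∈)))) ⟩
      sumℤ (map (λ T → sumℤ (map (∂weight j) (insT (suc (suc (suc k))) T))) G)
        ≡⟨ sum-concatMap (∂weight j) (insT (suc (suc (suc k)))) G ⟨
      sumℤ (map (∂weight j) (gregTrees (suc (suc (suc k))))) ∎
      where
      open ≡-Reasoning
      G = gregTrees (suc (suc k))
      ∂Q : ℕ → ℤ
      ∂Q i = ∂eval x (y + 1ℤ) z (t - 1ℤ) i (Q (suc k))
      cong₃ : ∀ {A B C D : Set} (f : A → B → C → D) {a a' b b' c c'} → a ≡ a' → b ≡ b' → c ≡ c' → f a b c ≡ f a' b' c'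
      cong₃ f refl refl refl = refl


open import Defs
open Derivatives using (∂eval; eval-∂eval)
open GregTrees using (gregTrees; gregTrees-enumerate)
open Recurrence using (module TreeSums)
open import Data.Nat using (ℕ; suc; _≤_)
open import Data.Integer using (ℤ; _+_; _-_; 1ℤ)
open import Data.Integer.Properties using (+-0-commutativeMonoid)
open import Algebra.Bundles using (CommutativeMonoid)
open import Data.List using (List; map)
import Data.List.Properties as LP
open import Data.Product using (_×_; ∃; _,_)
open import Relation.Binary.PropositionalEquality
open import Function.Bundles using (mk⇔; Equivalence)
open import Data.List.Relation.Binary.Permutation.Propositional using (_↭_; ↭⇒↭ₛ)
open import Data.List.Relation.Binary.Permutation.Setoid.Properties using (foldr-commMonoid)
import Data.List.Relation.Binary.Permutation.Propositional.Properties as PermProps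
open import Data.List.Membership.Propositional.Properties.WithK using (unique∧set⇒bag)
open import Data.List.Relation.Binary.BagAndSetEquality using (∼bag⇒↭)

sum-↭ : ∀ {xs ys : List ℤ} → xs ↭ ys → sumℤ xs ≡ sumℤ ys
sum-↭ p = foldr-commMonoid ℤ-+.setoid ℤ-+.isCommutativeMonoid (↭⇒↭ₛ p)
  where module ℤ-+ = CommutativeMonoid +-0-commutativeMonoid

enumerations-↭ : ∀ {m L L'} → Enumerates m L → Enumerates m L' → L ↭ L'
enumerations-↭ (uniqueL , memL) (uniqueL' , memL') = ∼bag⇒↭ (unique∧set⇒bag uniqueL uniqueL'
  (λ {T} → mk⇔ (λ p → Equivalence.from (memL' T) (Equivalence.to (memL T) p))
               (λ p → Equivalence.from (memL T) (Equivalence.to (memL' T) p))))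

theorem12 : (n : ℕ) → 1 ≤ n →
    (∃ λ (L : List Tree) → Enumerates (suc n) L) ×
    ((L : List Tree) → Enumerates (suc n) L →
      (x y z t : ℤ) → R n x y z t ≡ sumℤ (map (weight x y z t) L))
theorem12 (suc k) _ = (G , gregTrees-enumerate (suc k)) , λ L enumL x y z t →
  let open TreeSums x y z t in begin
    R (suc k) x y z t
      ≡⟨ eval-∂eval (Q (suc k)) x (y + 1ℤ) z (t - 1ℤ) ⟩
    ∂eval x (y + 1ℤ) z (t - 1ℤ) 0 (Q (suc k))
      ≡⟨ ∂Q-trees k 0 ⟩
    sumℤ (map (∂weight 0) G)
      ≡⟨ cong sumℤ (LP.map-cong ∂weight-zero G) ⟩
    sumℤ (map (weight x y z t) G)
      ≡⟨ sum-↭ (PermProps.map⁺ (weight x y z t) (enumerations-↭ (gregTrees-enumerate (suc k)) enumL)) ⟩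
    sumℤ (map (weight x y z t) L) ∎
  where
  open ≡-Reasoning
  G = gregTrees (suc (suc k))
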